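{- Let $\Gamma$ be a strictly Deza graph with parameters $(n,k,b,a)$ such that $k=b+1$ and $\beta(\Gamma)>1$. Then either every vertex of $\Gamma$ is of type (A1) or (C), or every vertex of $\Gamma$ is of type (A2) or (B).
   Context: Graphs are finite, simple, undirected. $N(v)$ is the neighbourhood of $v$ and $N_2(v)$ the set of vertices at distance $2$ from $v$. A Deza graph with parameters $(n,k,b,a)$, $b\ge a$, is a nonempty $k$-regular graph on $n$ vertices in which every pair of distinct vertices has exactly $b$ or exactly $a$ common neighbours; it is strictly Deza if it has diameter $2$ and is not strongly regular. $B(v)=\{u: |N(u)\cap N(v)|=b\}$; $\beta(\Gamma)=|B(v)|$ (independent of $v$). A vertex $v$ is of type (A) if $B(v)\cap N(v)=\emptyset$, of type (B) if $B(v)\subset N(v)$, of type (C) if $|B(v)\cap N(v)|=1$. A vertex $x$ of type (A) is of type (A1) if there is a unique $y\in N(x)$ with $\{y\}=N(x)\setminus N(x_i)$ for all $x_i\in B(x)$ and $|\bigcup_{x_i\in B(x)}(N(x_i)\setminus N(x))|=\beta(\Gamma)$; it is of type (A2) if there is a unique $z\in N_2(x)$ with $\{z\}=N(x_i)\setminus N(x)$ for all $x_i\in B(x)$ and $|\bigcup_{x_i\in B(x)}(N(x)\setminus N(x_i))|=\beta(\Gamma)$. -}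

module Defs where

open import Data.Nat using (ℕ; _<_; _≤_; suc)
open import Data.Bool using (Bool; true; false; not; _∧_)
open import Data.Fin using (Fin)
open import Data.Fin.Properties using (_≟_)
open import Data.Fin.Subset using (Subset; _∈_; _⊆_; _∩_; _∪_; _─_; ⁅_⁆; ∣_∣)
open import Data.Vec using (tabulate)
open import Data.List using (List)
open import Data.Bool.ListAction using (any)
open import Data.List.Base using (allFin)
open import Data.Product using (Σ; _×_; ∃; ∃-syntax)
open import Data.Sum using (_⊎_)
open import Relation.Nullary using (¬_)
open import Relation.Nullary.Decidable using (⌊_⌋)
open import Relation.Binary.PropositionalEquality using (_≡_)
import Data.Nat as ℕ

record Graph (n : ℕ) : Set where
  field
    adj   : Fin n → Fin n → Bool
    sym   : ∀ u v → adj u v ≡ adj v u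
    irrefl : ∀ v → adj v v ≡ false

module _ {n : ℕ} (Γ : Graph n) where
  open Graph Γ

  Adj : Fin n → Fin n → Set
  Adj u v = adj u v ≡ true

  N : Fin n → Subset n
  N v = tabulate (adj v)

  common : Fin n → Fin n → ℕ
  common u v = ∣ N u ∩ N v ∣

  Regular : ℕ → Set
  Regular k = ∀ v → ∣ N v ∣ ≡ k

  IsDeza : ℕ → ℕ → ℕ → Set
  IsDeza k b a =
    (0 < n) × Regular k × (a ≤ b) ×
    (∀ u v → ¬ (u ≡ v) → (common u v ≡ b ⊎ common u v ≡ a))

  Diameter2 : Set
  Diameter2 =
    (∀ u v → ¬ (u ≡ v) → Adj u v ⊎ (∃[ w ] (Adj u w × Adj w v))) ×
    (∃[ u ] ∃[ v ] (¬ (u ≡ v) × ¬ Adj u v))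

  StronglyRegular : Set
  StronglyRegular =
    ∃[ k ] ∃[ l ] ∃[ m ]
      (Regular k ×
       (∀ u v → Adj u v → common u v ≡ l) ×
       (∀ u v → ¬ (u ≡ v) → ¬ Adj u v → common u v ≡ m))

  IsStrictlyDeza : ℕ → ℕ → ℕ → Set
  IsStrictlyDeza k b a = IsDeza k b a × Diameter2 × ¬ StronglyRegular

  module _ (b : ℕ) where
    inB : Fin n → Fin n → Bool
    inB v u = not ⌊ u ≟ v ⌋ ∧ ⌊ common u v ℕ.≟ b ⌋

    B : Fin n → Subset n
    B v = tabulate (inB v)

    -- ⋃_{x_i ∈ B(x)} (N(x_i) \ N(x))
    unionOut : Fin n → Subset n
    unionOut x = tabulate (λ w → any (λ xi → inB x xi ∧ (adj xi w ∧ not (adj x w))) (allFin n))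

    -- ⋃_{x_i ∈ B(x)} (N(x) \ N(x_i))
    unionIn : Fin n → Subset n
    unionIn x = tabulate (λ w → any (λ xi → inB x xi ∧ (adj x w ∧ not (adj xi w))) (allFin n))

    Dist2 : Fin n → Fin n → Set
    Dist2 x z = ¬ (x ≡ z) × ¬ Adj x z × (∃[ w ] (Adj x w × Adj w z))

    TypeA : Fin n → Set
    TypeA v = ∀ u → u ∈ B v → ¬ Adj v u

    TypeB : Fin n → Set
    TypeB v = B v ⊆ N v

    TypeC : Fin n → Set
    TypeC v = ∣ B v ∩ N v ∣ ≡ 1

    A1wit : Fin n → Fin n → Set
    A1wit x y = Adj x y × (∀ xi → xi ∈ B x → (N x ─ N xi) ≡ ⁅ y ⁆)

    TypeA1 : Fin n → Set
    TypeA1 x = TypeA x ×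
      (∃[ y ] (A1wit x y × (∀ y' → A1wit x y' → y' ≡ y))) ×
      (∣ unionOut x ∣ ≡ ∣ B x ∣)

    A2wit : Fin n → Fin n → Set
    A2wit x z = Dist2 x z × (∀ xi → xi ∈ B x → (N xi ─ N x) ≡ ⁅ z ⁆)

    TypeA2 : Fin n → Set
    TypeA2 x = TypeA x ×
      (∃[ z ] (A2wit x z × (∀ z' → A2wit x z' → z' ≡ z))) ×
      (∣ unionIn x ∣ ≡ ∣ B x ∣)

module Submission where

-- For u ∈ B(x) the condition k = b + 1 means that N(u) arises from N(x) by exchanging a single
-- vertex: N(u) = N(x) − y + z.  For two members u, v of B(x), N(x) ⊆ (N(u) ∩ N(v)) ∪ {y_u, y_v},
-- so u and v share at least b − 1 neighbours; a counting argument around a pair of vertices at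
-- distance 2 rules out a = b − 1, hence u ∈ B(v), and {x} ∪ B(x) is an equivalence class of size
-- β + 1 ≥ 3 for the relation "equal or b common neighbours".  Two members of B(x) always agree on
-- their y or on their z but never on both, so since β ≥ 2 either all y's coincide (then x is of
-- type (A1) or (C)) or all z's coincide (type (A2) or (B)).  In the first case N(x) − y, in the
-- second N(x) + z is a union of classes, so β + 1 divides b, respectively b + 2; as β is the same
-- for all vertices and β + 1 ∤ 2, both cases cannot occur in one graph.

open import Defs
open import Data.Nat using (ℕ; zero; suc; _+_; _*_; _≤_; _<_; z≤n; s≤s)
import Data.Nat as ℕ
open import Data.Nat.Properties
  using ( +-*-semiring; +-assoc; +-comm; +-suc; +-identityʳ; *-identityʳ; *-zeroʳ
        ; +-mono-≤; +-monoˡ-≤; +-monoʳ-≤; +-cancelˡ-≤; +-cancelʳ-≤; +-cancelˡ-≡; *-cancelʳ-≡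
        ; ≤-refl; ≤-trans; ≤-reflexive; ≤-antisym; ≤-total; ≤-pred; _≤?_; ≰⇒>; n≤1+n; n<1+n; n≮0
        ; <-irrefl; n≤0⇒n≡0; n≢0⇒n>0; m≤n⇒m<n∨m≡n; m≤n⇒∃[o]m+o≡n; suc-injective; module ≤-Reasoning )
open import Data.Nat.Divisibility using (_∣_; _∣0; ∣-refl; ∣m∣n⇒∣m+n; ∣m+n∣m⇒∣n; ∣⇒≤)
open import Data.Nat.Solver using (module +-*-Solver)
open +-*-Solver using (solve; _:+_; _:*_; _:=_; con)
open import Algebra.Properties.Semiring.Sum +-*-semiring
  using (sum; sum-cong-≗; ∑-distrib-+; ∑-comm; *-distribˡ-sum)
open import Data.Bool using (Bool; true; false; not; _∧_; _∨_)
open import Data.Bool.Properties using (∨-zeroʳ; ∧-comm; ∧-idem; T-≡; ¬-not; not-¬)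
open import Data.Bool.ListAction using (any)
open import Data.Fin using (Fin; zero; suc)
open import Data.Fin.Properties using (_≟_)
open import Data.Fin.Subset using (_∈_; _∩_; _─_; ⁅_⁆; ∣_∣) renaming (⊥ to ∅)
open import Data.Fin.Subset.Properties using (x∈⁅x⁆; x∈⁅y⁆⇒x≡y; ∣⁅x⁆∣≡1)
open import Data.Vec using (tabulate; lookup; _∷_)
open import Data.Vec.Properties using (lookup∘tabulate; tabulate-cong; []=⇒lookup; lookup⇒[]=)
open import Data.List using (allFin)
open import Data.List.Membership.Propositional using (lose)
open import Data.List.Membership.Propositional.Properties using (∈-allFin)
open import Data.List.Relation.Unary.Any using (satisfied)
open import Data.List.Relation.Unary.Any.Properties using (any⁺; any⁻)
open import Data.Product using (_×_; _,_; proj₁; proj₂; ∃; ∃-syntax)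
import Data.Product as Product
open import Data.Sum using (_⊎_; inj₁; inj₂; [_,_])
import Data.Sum as Sum
open import Data.Empty using (⊥; ⊥-elim)
open import Function using (_∘_)
open import Function.Bundles using (Equivalence)
open import Relation.Nullary using (¬_; Dec; yes; no)
open import Relation.Nullary.Decidable using (⌊_⌋)
open import Relation.Binary.PropositionalEquality
  using (_≡_; _≢_; _≗_; refl; sym; trans; ≢-sym; cong; cong₂; subst; subst₂; module ≡-Reasoning)

∧≡true : ∀ {s t : Bool} → s ∧ t ≡ true → s ≡ true × t ≡ true
∧≡true {true} {true} _ = refl , refl

∨≡true : ∀ {s t : Bool} → s ∨ t ≡ true → s ≡ true ⊎ t ≡ true
∨≡true {true}  _   = inj₁ refl
∨≡true {false} t≡true = inj₂ t≡true

∨-introʳ : ∀ {s t : Bool} → t ≡ true → s ∨ t ≡ true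
∨-introʳ {true}  _ = refl
∨-introʳ {false} t≡true = t≡true

∧-implied : ∀ {s t : Bool} → (s ≡ true → t ≡ true) → s ∧ t ≡ s
∧-implied {true}  s⇒t = s⇒t refl
∧-implied {false} _   = refl

∧-not-intro : ∀ {s t : Bool} → s ≡ true → t ≡ false → s ∧ not t ≡ true
∧-not-intro refl refl = refl

∧-not≡true : ∀ {s t : Bool} → s ∧ not t ≡ true → s ≡ true × t ≡ false
∧-not≡true {true} {false} _ = refl , refl

+-cancelʳ-≤-by : ∀ {m n p q} → m + n ≤ p + q → q ≤ n → m ≤ p
+-cancelʳ-≤-by {m} {n} {p} {q} m+n≤p+q q≤n = +-cancelʳ-≤ q m p (≤-trans (+-monoʳ-≤ m q≤n) m+n≤p+q)

+-cancelˡ-≤-by : ∀ {m n p q} → n + m ≤ q + p → q ≤ n → m ≤ p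
+-cancelˡ-≤-by {m} {n} {p} {q} n+m≤q+p =
  +-cancelʳ-≤-by (subst₂ _≤_ (+-comm n m) (+-comm q p) n+m≤q+p)

¬three-large : ∀ {x y z b} → 3 ≤ b → x + y + z ≤ suc b → b ≤ suc x → b ≤ suc y → b ≤ suc z → ⊥
¬three-large {x} {y} {z} {b} (s≤s (s≤s (s≤s {n = c} _))) sum≤ (s≤s b≤x) (s≤s b≤y) (s≤s b≤z) =
  ¬6≤4 (+-cancelʳ-≤ c 6 4 (begin
    6 + c                      ≡⟨ cong (λ m → suc (suc m)) (sym (trans (+-assoc c 2 2) (+-comm c 4))) ⟩
    2 + c + 2 + 2              ≤⟨ +-mono-≤ (+-mono-≤ b≤x (≤-trans (s≤s (s≤s z≤n)) b≤y)) (≤-trans (s≤s (s≤s z≤n)) b≤z) ⟩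
    x + y + z                  ≤⟨ sum≤ ⟩
    4 + c                      ∎))
  where
  open ≤-Reasoning
  ¬6≤4 : ¬ (6 ≤ 4)
  ¬6≤4 (s≤s (s≤s (s≤s (s≤s ()))))

private
  weights-cancel-≤ : ∀ {a b p q p′ q′} → a < b → p + q ≡ p′ + q′ → b * p + a * q ≡ b * p′ + a * q′ →
    p ≤ p′ → p ≡ p′
  weights-cancel-≤ {a} {b} {p} {q} {p′} {q′} a<b sums weighted p≤p′ with m≤n⇒∃[o]m+o≡n p≤p′
  ... | zero  , refl = sym (+-identityʳ p)
  ... | suc d , refl = ⊥-elim (<-irrefl (*-cancelʳ-≡ a b (suc d) ad≡bd) a<b)
    where
    q≡ : q ≡ suc d + q′
    q≡ = +-cancelˡ-≡ p q (suc d + q′) (trans sums (+-assoc p (suc d) q′))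
    ad≡bd : a * suc d ≡ b * suc d
    ad≡bd = +-cancelˡ-≡ (b * p + a * q′) (a * suc d) (b * suc d) (begin
      b * p + a * q′ + a * suc d    ≡⟨ shuffle b p a (suc d) q′ ⟨
      b * p + a * (suc d + q′)      ≡⟨ cong (λ t → b * p + a * t) q≡ ⟨
      b * p + a * q                 ≡⟨ weighted ⟩
      b * (p + suc d) + a * q′      ≡⟨ shuffle′ b p a (suc d) q′ ⟩
      b * p + a * q′ + b * suc d    ∎)
      where
      open ≡-Reasoning
      shuffle : ∀ b p a d q → b * p + a * (d + q) ≡ b * p + a * q + a * d
      shuffle = solve 5 (λ b p a d q → b :* p :+ a :* (d :+ q) := b :* p :+ a :* q :+ a :* d) refl
      shuffle′ : ∀ b p a d q → b * (p + d) + a * q ≡ b * p + a * q + b * d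
      shuffle′ = solve 5 (λ b p a d q → b :* (p :+ d) :+ a :* q := b :* p :+ a :* q :+ b :* d) refl

  select₁ : ∀ x y z → x * 1 + y * 0 + z * 0 ≡ x
  select₁ = solve 3 (λ x y z → x :* con 1 :+ y :* con 0 :+ z :* con 0 := x) refl

  select₂ : ∀ x y z → x * 0 + y * 1 + z * 0 ≡ y
  select₂ = solve 3 (λ x y z → x :* con 0 :+ y :* con 1 :+ z :* con 0 := y) refl

  select₃ : ∀ x y z → x * 0 + y * 0 + z * 1 ≡ z
  select₃ = solve 3 (λ x y z → x :* con 0 :+ y :* con 0 :+ z :* con 1 := z) refl

weights-cancel : ∀ {a b p q p′ q′} → a < b → p + q ≡ p′ + q′ → b * p + a * q ≡ b * p′ + a * q′ → p ≡ p′
weights-cancel a<b sums weighted with ≤-total _ _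
... | inj₁ p≤p′ = weights-cancel-≤ a<b sums weighted p≤p′
... | inj₂ p′≤p = sym (weights-cancel-≤ a<b (sym sums) (sym weighted) p′≤p)

-- Counting the elements of a Boolean predicate on Fin n

indicator : Bool → ℕ
indicator true  = 1
indicator false = 0

count : ∀ {n} → (Fin n → Bool) → ℕ
count p = sum (indicator ∘ p)

_==_ : ∀ {n} → Fin n → Fin n → Bool
i == j = ⌊ i ≟ j ⌋

∣tabulate∣≡count : ∀ {n} (p : Fin n → Bool) → ∣ tabulate p ∣ ≡ count p
∣tabulate∣≡count {zero}  p = refl
∣tabulate∣≡count {suc n} p with p zero
... | true  = cong suc (∣tabulate∣≡count (p ∘ suc))
... | false = ∣tabulate∣≡count (p ∘ suc)

==-refl : ∀ {n} (i : Fin n) → i == i ≡ true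
==-refl i with i ≟ i
... | yes _   = refl
... | no i≢i = ⊥-elim (i≢i refl)

==⇒≡ : ∀ {n} {i j : Fin n} → i == j ≡ true → i ≡ j
==⇒≡ {i = i} {j} e with i ≟ j
... | yes i≡j = i≡j

≡⇒== : ∀ {n} {i j : Fin n} → i ≡ j → i == j ≡ true
≡⇒== {i = i} refl = ==-refl i

≢⇒==-false : ∀ {n} {i j : Fin n} → i ≢ j → i == j ≡ false
≢⇒==-false {i = i} {j} i≢j with i ≟ j
... | yes i≡j = ⊥-elim (i≢j i≡j)
... | no _    = refl

==-suc : ∀ {n} (j i : Fin n) → suc j == suc i ≡ j == i
==-suc j i with j ≟ i
... | yes _ = refl
... | no _  = refl

count-cong : ∀ {n} {p q : Fin n → Bool} → p ≗ q → count p ≡ count q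
count-cong p≗q = sum-cong-≗ (cong indicator ∘ p≗q)

count-false : ∀ {n} (p : Fin n → Bool) → (∀ i → p i ≡ false) → count p ≡ 0
count-false {zero}  p p≡false = refl
count-false {suc n} p p≡false rewrite p≡false zero = count-false (p ∘ suc) (p≡false ∘ suc)

sum-mono : ∀ {n} {f g : Fin n → ℕ} → (∀ i → f i ≤ g i) → sum f ≤ sum g
sum-mono {zero}  f≤g = z≤n
sum-mono {suc n} f≤g = +-mono-≤ (f≤g zero) (sum-mono (f≤g ∘ suc))

count-mono : ∀ {n} {p q : Fin n → Bool} → (∀ i → p i ≡ true → q i ≡ true) → count p ≤ count q
count-mono {p = p} {q} p⊆q = sum-mono pointwise
  where
  pointwise : ∀ i → indicator (p i) ≤ indicator (q i)
  pointwise i with p i | p⊆q i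
  ... | true  | p⊆qᵢ rewrite p⊆qᵢ refl = ≤-refl
  ... | false | _ = z≤n

count-split : ∀ {n} (p q : Fin n → Bool) →
  count p ≡ count (λ i → p i ∧ q i) + count (λ i → p i ∧ not (q i))
count-split p q = trans (sum-cong-≗ split) (∑-distrib-+ (λ i → indicator (p i ∧ q i)) _)
  where
  split : ∀ i → indicator (p i) ≡ indicator (p i ∧ q i) + indicator (p i ∧ not (q i))
  split i with p i | q i
  ... | true  | true  = refl
  ... | true  | false = refl
  ... | false | _     = refl

count-∨ : ∀ {n} (p q : Fin n → Bool) → (∀ i → p i ∧ q i ≡ false) →
  count (λ i → p i ∨ q i) ≡ count p + count q
count-∨ p q disjoint = trans (sum-cong-≗ split) (∑-distrib-+ (indicator ∘ p) _)
  where
  split : ∀ i → indicator (p i ∨ q i) ≡ indicator (p i) + indicator (q i)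
  split i with p i | q i | disjoint i
  ... | true  | false | _ = refl
  ... | false | _     | _ = refl

count-disjoint-≤ : ∀ {n} (p q r : Fin n → Bool) → (∀ i → p i ∧ q i ≡ false) →
  (∀ i → p i ≡ true → r i ≡ true) → (∀ i → q i ≡ true → r i ≡ true) → count p + count q ≤ count r
count-disjoint-≤ p q r disjoint p⊆r q⊆r = subst (_≤ count r) (count-∨ p q disjoint) (count-mono p∨q⊆r)
  where
  p∨q⊆r : ∀ i → p i ∨ q i ≡ true → r i ≡ true
  p∨q⊆r i p∨qi with p i in pi
  ... | true  = p⊆r i pi
  ... | false = q⊆r i p∨qi

count-disjoint₃-≤ : ∀ {n} (p q r s : Fin n → Bool) →
  (∀ i → p i ∧ q i ≡ false) → (∀ i → p i ∧ r i ≡ false) → (∀ i → q i ∧ r i ≡ false) →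
  (∀ i → p i ≡ true → s i ≡ true) → (∀ i → q i ≡ true → s i ≡ true) → (∀ i → r i ≡ true → s i ≡ true) →
  count p + count q + count r ≤ count s
count-disjoint₃-≤ p q r s pq pr qr p⊆s q⊆s r⊆s =
  subst (λ c → c + count r ≤ count s) (count-∨ p q pq)
    (count-disjoint-≤ (λ i → p i ∨ q i) r s p∨q∩r p∨q⊆s r⊆s)
  where
  p∨q∩r : ∀ i → (p i ∨ q i) ∧ r i ≡ false
  p∨q∩r i with p i in pi
  ... | true  = trans (cong (_∧ r i) (sym pi)) (pr i)
  ... | false = qr i
  p∨q⊆s : ∀ i → p i ∨ q i ≡ true → s i ≡ true
  p∨q⊆s i p∨qi with p i in pi
  ... | true  = p⊆s i pi
  ... | false = q⊆s i p∨qi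

count-∨-≤ : ∀ {n} (p q : Fin n → Bool) → count (λ i → p i ∨ q i) ≤ count p + count q
count-∨-≤ p q = subst (count (λ i → p i ∨ q i) ≤_) (∑-distrib-+ (indicator ∘ p) (indicator ∘ q)) (sum-mono split)
  where
  split : ∀ i → indicator (p i ∨ q i) ≤ indicator (p i) + indicator (q i)
  split i with p i | q i
  ... | true  | _     = s≤s z≤n
  ... | false | true  = s≤s z≤n
  ... | false | false = z≤n

count-== : ∀ {n} (i : Fin n) → count (_== i) ≡ 1
count-== {suc n} zero    = cong suc (count-false {n} (λ j → suc j == zero) (λ _ → refl))
count-== {suc n} (suc i) = trans (count-cong (λ j → ==-suc j i)) (count-== i)

_∖_ : ∀ {n} → (Fin n → Bool) → Fin n → (Fin n → Bool)
(p ∖ i) j = p j ∧ not (j == i)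

∖-intro : ∀ {n} (p : Fin n → Bool) {i j} → p j ≡ true → j ≢ i → (p ∖ i) j ≡ true
∖-intro p pj j≢i rewrite pj | ≢⇒==-false j≢i = refl

∖-elim : ∀ {n} (p : Fin n → Bool) {i j} → (p ∖ i) j ≡ true → p j ≡ true × j ≢ i
∖-elim p {i} {j} e with p j | j ≟ i
... | true | no j≢i = refl , j≢i

count-∖ : ∀ {n} (p : Fin n → Bool) {i} → p i ≡ true → count p ≡ suc (count (p ∖ i))
count-∖ p {i} pi = trans (count-split p (_== i))
  (cong (_+ count (p ∖ i)) (trans (count-cong p∧==i) (count-== i)))
  where
  p∧==i : ∀ j → p j ∧ (j == i) ≡ (j == i)
  p∧==i j with j ≟ i
  ... | yes refl rewrite pi = refl
  ... | no _ with p j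
  ...   | true  = refl
  ...   | false = refl

0<count : ∀ {n} (p : Fin n → Bool) {i} → p i ≡ true → 0 < count p
0<count p pi = subst (0 <_) (sym (count-∖ p pi)) (s≤s z≤n)

count-witness : ∀ {n} (p : Fin n → Bool) → 0 < count p → ∃ λ i → p i ≡ true
count-witness {suc n} p 0<c with p zero in p₀
... | true  = zero , p₀
... | false with count-witness (p ∘ suc) 0<c
...   | i , pi = suc i , pi

count≡0 : ∀ {n} (p : Fin n → Bool) {i} → count p ≡ 0 → p i ≡ true → ⊥
count≡0 p c≡0 pi = <-irrefl (sym c≡0) (0<count p pi)

count≡1⇒unique : ∀ {n} (p : Fin n → Bool) {i j} → count p ≡ 1 →
  p i ≡ true → p j ≡ true → j ≡ i
count≡1⇒unique p {i} {j} c≡1 pi pj with j ≟ i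
... | yes j≡i = j≡i
... | no j≢i  = ⊥-elim (count≡0 (p ∖ i) (suc-injective (trans (sym (count-∖ p pi)) c≡1)) (∖-intro p pj j≢i))

count≡1⇒∃! : ∀ {n} (p : Fin n → Bool) → count p ≡ 1 →
  ∃ λ i → p i ≡ true × (∀ j → p j ≡ true → j ≡ i)
count≡1⇒∃! p c≡1 with count-witness p (subst (0 <_) (sym c≡1) (s≤s z≤n))
... | i , pi = i , pi , λ j pj → count≡1⇒unique p c≡1 pi pj

2≤count : ∀ {n} (p : Fin n → Bool) {i j} → p i ≡ true → p j ≡ true → j ≢ i → 2 ≤ count p
2≤count p {i} pi pj j≢i = subst (2 ≤_) (sym (count-∖ p pi)) (s≤s (0<count (p ∖ i) (∖-intro p pj j≢i)))

3≤count : ∀ {n} (p : Fin n → Bool) {i j l} → p i ≡ true → p j ≡ true → p l ≡ true →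
  j ≢ i → l ≢ i → l ≢ j → 3 ≤ count p
3≤count p {i} pi pj pl j≢i l≢i l≢j = subst (3 ≤_) (sym (count-∖ p pi))
  (s≤s (2≤count (p ∖ i) (∖-intro p pj j≢i) (∖-intro p pl l≢i) l≢j))

2≤count⇒another : ∀ {n} (p : Fin n → Bool) {i} → 2 ≤ count p → p i ≡ true →
  ∃ λ j → p j ≡ true × j ≢ i
2≤count⇒another p {i} 2≤c pi with count-witness (p ∖ i) (≤-pred (subst (2 ≤_) (count-∖ p pi) 2≤c))
... | j , p∖ij = j , ∖-elim p p∖ij

count≡2⇒⊆ : ∀ {n} (p : Fin n → Bool) {i j} → count p ≡ 2 → p i ≡ true → p j ≡ true → j ≢ i →
  ∀ l → p l ≡ true → l ≡ i ⊎ l ≡ j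
count≡2⇒⊆ p {i} {j} c≡2 pi pj j≢i l pl with l ≟ i | l ≟ j
... | yes l≡i | _       = inj₁ l≡i
... | no _    | yes l≡j = inj₂ l≡j
... | no l≢i  | no l≢j  = ⊥-elim (<-irrefl (sym c≡2) (3≤count p pi pj pl j≢i l≢i l≢j))

count≡3⇒⊆ : ∀ {n} (p : Fin n → Bool) {i j l} → count p ≡ 3 →
  p i ≡ true → p j ≡ true → p l ≡ true → j ≢ i → l ≢ i → l ≢ j →
  ∀ m → p m ≡ true → m ≡ i ⊎ m ≡ j ⊎ m ≡ l
count≡3⇒⊆ p {i} c≡3 pi pj pl j≢i l≢i l≢j m pm with m ≟ i
... | yes m≡i = inj₁ m≡i
... | no m≢i  = inj₂ (count≡2⇒⊆ (p ∖ i) (suc-injective (trans (sym (count-∖ p pi)) c≡3))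
                        (∖-intro p pj j≢i) (∖-intro p pl l≢i) l≢j m (∖-intro p pm m≢i))

count≤+2 : ∀ {n} (p q : Fin n → Bool) (i j : Fin n) →
  (∀ l → p l ≡ true → q l ≡ true ⊎ l ≡ i ⊎ l ≡ j) → count p ≤ count q + 2
count≤+2 p q i j covered = begin
  count p                                       ≤⟨ count-mono inUnion ⟩
  count (λ l → q l ∨ (l == i ∨ l == j))         ≤⟨ count-∨-≤ q _ ⟩
  count q + count (λ l → l == i ∨ l == j)       ≤⟨ +-monoʳ-≤ (count q) (count-∨-≤ (_== i) (_== j)) ⟩
  count q + (count (_== i) + count (_== j))     ≡⟨ cong (count q +_) (cong₂ _+_ (count-== i) (count-== j)) ⟩
  count q + 2                                   ∎
  where
  open ≤-Reasoning
  inUnion : ∀ l → p l ≡ true → q l ∨ (l == i ∨ l == j) ≡ true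
  inUnion l pl with covered l pl
  ... | inj₁ ql rewrite ql = refl
  ... | inj₂ (inj₁ refl) rewrite ==-refl l | ∨-zeroʳ (q l) = refl
  ... | inj₂ (inj₂ refl) rewrite ==-refl l | ∨-zeroʳ (l == i) | ∨-zeroʳ (q l) = refl

double-count : ∀ {m n} (T : Fin m → Fin n → Bool) {X : Fin m → Bool} {Y : Fin n → Bool} →
  (∀ i → count (T i) ≡ indicator (X i)) → (∀ j → count (λ i → T i j) ≡ indicator (Y j)) →
  count X ≡ count Y
double-count T {X} {Y} rows columns = begin
  sum (indicator ∘ X)                         ≡⟨ sum-cong-≗ (sym ∘ rows) ⟩
  sum (λ i → sum (λ j → indicator (T i j)))   ≡⟨ ∑-comm (λ i j → indicator (T i j)) ⟩
  sum (λ j → sum (λ i → indicator (T i j)))   ≡⟨ sum-cong-≗ columns ⟩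
  sum (indicator ∘ Y)                         ∎
  where open ≡-Reasoning

any-allFin⁺ : ∀ {n} (p : Fin n → Bool) {i} → p i ≡ true → any p (allFin n) ≡ true
any-allFin⁺ p {i} pi = Equivalence.to T-≡ (any⁺ p (lose (∈-allFin i) (Equivalence.from T-≡ pi)))

any-allFin⁻ : ∀ {n} (p : Fin n → Bool) → any p (allFin n) ≡ true → ∃ λ i → p i ≡ true
any-allFin⁻ p e = Product.map₂ (Equivalence.to T-≡) (satisfied (any⁻ p (allFin _) (Equivalence.from T-≡ e)))

count≡indicator-any : ∀ {n} (p : Fin n → Bool) → (∀ i j → p i ≡ true → p j ≡ true → i ≡ j) →
  count p ≡ indicator (any p (allFin n))
count≡indicator-any p atMostOne with any p (allFin _) in anyp
... | false = count-false p none
  where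
  none : ∀ i → p i ≡ false
  none i with p i in pi
  ... | false = refl
  ... | true  with () ← trans (sym (any-allFin⁺ p pi)) anyp
... | true with any-allFin⁻ p anyp
...   | i , pi = trans (count-∖ p pi) (cong suc (count-false (p ∖ i) onlyI))
  where
  onlyI : ∀ j → (p ∖ i) j ≡ false
  onlyI j with p j in pj
  ... | false = refl
  ... | true rewrite atMostOne i j pi pj | ==-refl j = refl

count-⋃-singletons : ∀ {m n} (X : Fin m → Bool) (S : Fin m → Fin n → Bool) →
  (∀ i → X i ≡ true → count (S i) ≡ 1) →
  (∀ i j w → X i ≡ true → X j ≡ true → S i w ≡ true → S j w ≡ true → i ≡ j) →
  count (λ w → any (λ i → X i ∧ S i w) (allFin m)) ≡ count X
count-⋃-singletons X S singleton disjoint = sym (double-count (λ i w → X i ∧ S i w) row column)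
  where
  row : ∀ i → count (λ w → X i ∧ S i w) ≡ indicator (X i)
  row i with X i in Xi
  ... | true  = singleton i Xi
  ... | false = count-false (λ w → false ∧ S i w) (λ _ → refl)
  column : ∀ w → count (λ i → X i ∧ S i w) ≡ indicator (any (λ i → X i ∧ S i w) (allFin _))
  column w = count≡indicator-any _ λ i j XSi XSj →
    disjoint i j w (proj₁ (∧≡true XSi)) (proj₁ (∧≡true XSj)) (proj₂ (∧≡true XSi)) (proj₂ (∧≡true XSj))

∑-scaled : ∀ {n} c (p : Fin n → Bool) → sum (λ i → c * indicator (p i)) ≡ c * count p
∑-scaled c p = sym (*-distribˡ-sum c (indicator ∘ p))

∑-distrib-+₃ : ∀ {n} (f g h : Fin n → ℕ) → sum (λ i → f i + g i + h i) ≡ sum f + sum g + sum h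
∑-distrib-+₃ f g h = trans (∑-distrib-+ (λ i → f i + g i) h) (cong (_+ sum h) (∑-distrib-+ f g))

count-true : ∀ n → count {n} (λ _ → true) ≡ n
count-true zero    = refl
count-true (suc n) = cong suc (count-true n)

count-complement : ∀ {n} (p : Fin n → Bool) → count p + count (not ∘ p) ≡ n
count-complement {n} p = trans (sym (count-split (λ _ → true) p)) (count-true n)

unique⇒≗== : ∀ {n} (p : Fin n → Bool) {i} → p i ≡ true → (∀ j → p j ≡ true → j ≡ i) → p ≗ (_== i)
unique⇒≗== p {i} pi unique j with j ≟ i
... | yes refl = pi
... | no j≢i with p j in pj
...   | true  = ⊥-elim (j≢i (unique j pj))
...   | false = refl

-- Boolean predicates as subsets

∈tabulate⇒ : ∀ {n} {p : Fin n → Bool} {i} → i ∈ tabulate p → p i ≡ true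
∈tabulate⇒ {p = p} {i} i∈p = trans (sym (lookup∘tabulate p i)) ([]=⇒lookup i∈p)

⇒∈tabulate : ∀ {n} {p : Fin n → Bool} {i} → p i ≡ true → i ∈ tabulate p
⇒∈tabulate {p = p} {i} pi = lookup⇒[]= i (tabulate p) (trans (lookup∘tabulate p i) pi)

tabulate-∩ : ∀ {n} (p q : Fin n → Bool) → tabulate p ∩ tabulate q ≡ tabulate (λ i → p i ∧ q i)
tabulate-∩ {zero}  p q = refl
tabulate-∩ {suc n} p q = cong (p zero ∧ q zero ∷_) (tabulate-∩ (p ∘ suc) (q ∘ suc))

tabulate-─ : ∀ {n} (p q : Fin n → Bool) → tabulate p ─ tabulate q ≡ tabulate (λ i → p i ∧ not (q i))
tabulate-─ {zero}  p q = refl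
tabulate-─ {suc n} p q with p zero | q zero | tabulate-─ (p ∘ suc) (q ∘ suc)
... | true  | true  | rest = cong (false ∷_) rest
... | true  | false | rest = cong (true ∷_) rest
... | false | true  | rest = cong (false ∷_) rest
... | false | false | rest = cong (false ∷_) rest

tabulate-==≡⁅⁆ : ∀ {n} (i : Fin n) → tabulate (_== i) ≡ ⁅ i ⁆
tabulate-==≡⁅⁆ {suc n} zero    = cong (true ∷_) (tabulate-false n)
  where
  tabulate-false : ∀ m → tabulate {m} (λ _ → false) ≡ ∅
  tabulate-false zero    = refl
  tabulate-false (suc m) = cong (false ∷_) (tabulate-false m)
tabulate-==≡⁅⁆ {suc n} (suc i) = cong (false ∷_) (trans (tabulate-cong (λ j → ==-suc j i)) (tabulate-==≡⁅⁆ i))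

tabulate≡⁅⁆ : ∀ {n} (p : Fin n → Bool) {i} → p ≗ (_== i) → tabulate p ≡ ⁅ i ⁆
tabulate≡⁅⁆ p {i} p≗==i = trans (tabulate-cong p≗==i) (tabulate-==≡⁅⁆ i)

⁅⁆-injective : ∀ {n} {i j : Fin n} → ⁅ i ⁆ ≡ ⁅ j ⁆ → i ≡ j
⁅⁆-injective {i = i} {j} eq = x∈⁅y⁆⇒x≡y j (subst (i ∈_) eq (x∈⁅x⁆ i))

-- Equivalence relations with classes of equal size

Closed : ∀ {n} → (Fin n → Fin n → Bool) → (Fin n → Bool) → Set
Closed R S = ∀ {u v} → S u ≡ true → R u v ≡ true → S v ≡ true

module _ {n} (R : Fin n → Fin n → Bool) (s : ℕ)
  (R-refl : ∀ v → R v v ≡ true) (R-sym : ∀ {u v} → R u v ≡ true → R v u ≡ true)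
  (R-trans : ∀ {u v w} → R u v ≡ true → R v w ≡ true → R u w ≡ true)
  (∣class∣≡s : ∀ v → count (R v) ≡ s) where

  -- A closed set is a disjoint union of classes: remove the class of one of its elements and recurse.
  private
    s∣closed : ∀ m (S : Fin n → Bool) → count S ≤ m → Closed R S → s ∣ count S
    s∣closed zero    S ∣S∣≤0 closed = subst (s ∣_) (sym (n≤0⇒n≡0 ∣S∣≤0)) (s ∣0)
    s∣closed (suc m) S ∣S∣≤m closed with ℕ._≟_ (count S) 0
    ... | yes ∣S∣≡0 = subst (s ∣_) (sym ∣S∣≡0) (s ∣0)
    ... | no ∣S∣≢0 with count-witness S (n≢0⇒n>0 ∣S∣≢0)
    ...   | v , Sv = subst (s ∣_) (sym split) (∣m∣n⇒∣m+n ∣-refl (s∣closed m S′ ∣S′∣≤m closed′))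
      where
      S′ : Fin n → Bool
      S′ u = S u ∧ not (R v u)
      split : count S ≡ s + count S′
      split = trans (count-split S (R v))
        (cong (_+ count S′) (trans (count-cong (λ u → trans (∧-comm (S u) (R v u)) (∧-implied (closed Sv)))) (∣class∣≡s v)))
      ∣S′∣≤m : count S′ ≤ m
      ∣S′∣≤m = ≤-pred (begin-strict
        count S′      <⟨ +-monoˡ-≤ (count S′) (subst (0 <_) (∣class∣≡s v) (0<count (R v) (R-refl v))) ⟩
        s + count S′  ≡⟨ split ⟨
        count S       ≤⟨ ∣S∣≤m ⟩
        suc m         ∎)
        where open ≤-Reasoning
      closed′ : Closed R S′
      closed′ {u} {w} S′u uRw with ∧-not≡true S′u
      ... | Su , ¬vRu = ∧-not-intro (closed Su uRw) (¬-not λ vRw → not-¬ (R-trans vRw (R-sym uRw)) ¬vRu)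

  closed⇒s∣ : ∀ (S : Fin n → Bool) → Closed R S → s ∣ count S
  closed⇒s∣ S = s∣closed (count S) S ≤-refl

module GraphFacts {n : ℕ} (Γ : Graph n) where
  open Graph Γ using (adj; irrefl)

  _∖N_ : Fin n → Fin n → Fin n → Bool
  (u ∖N v) w = adj u w ∧ not (adj v w)

  shared : Fin n → Fin n → ℕ
  shared u v = count (λ w → adj u w ∧ adj v w)

  common≡shared : ∀ u v → common Γ u v ≡ shared u v
  common≡shared u v = trans (cong ∣_∣ (tabulate-∩ (adj u) (adj v))) (∣tabulate∣≡count (λ w → adj u w ∧ adj v w))

  shared-comm : ∀ u v → shared u v ≡ shared v u
  shared-comm u v = count-cong (λ w → ∧-comm (adj u w) (adj v w))

  adj-sym : ∀ {u v} → adj u v ≡ true → adj v u ≡ true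
  adj-sym {u} {v} uv = trans (Graph.sym Γ v u) uv

  adj⇒≢ : ∀ {u v} → adj u v ≡ true → u ≢ v
  adj⇒≢ {u} uv refl with () ← trans (sym uv) (irrefl u)

  module _ (regular : Regular Γ 2) (diameter2 : Diameter2 Γ) where

    private
      degree : ∀ v → count (adj v) ≡ 2
      degree v = trans (sym (∣tabulate∣≡count (adj v))) (regular v)

      connected : ∀ u v → u ≢ v → Adj Γ u v ⊎ (∃[ w ] (Adj Γ u w × Adj Γ w v))
      connected = proj₁ diameter2

    -- In a 2-regular graph a triangle is a whole component, but the non-adjacent pair provides a
    -- vertex outside it, which is then at distance > 2 from u.
    triangle-free : ∀ {u v t} → adj u v ≡ true → adj u t ≡ true → adj v t ≡ true → ⊥
    triangle-free {u} {v} {t} uv ut vt = unreachable (outside (proj₂ diameter2))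
      where
      InT : Fin n → Set
      InT r = r ≡ u ⊎ r ≡ v ⊎ r ≡ t

      nbhd-in-T : ∀ {s r} → InT s → adj s r ≡ true → InT r
      nbhd-in-T (inj₁ refl) sr with count≡2⇒⊆ (adj u) (degree u) uv ut (adj⇒≢ (adj-sym vt)) _ sr
      ... | inj₁ r≡v = inj₂ (inj₁ r≡v)
      ... | inj₂ r≡t = inj₂ (inj₂ r≡t)
      nbhd-in-T (inj₂ (inj₁ refl)) sr with count≡2⇒⊆ (adj v) (degree v) (adj-sym uv) vt (adj⇒≢ (adj-sym ut)) _ sr
      ... | inj₁ r≡u = inj₁ r≡u
      ... | inj₂ r≡t = inj₂ (inj₂ r≡t)
      nbhd-in-T (inj₂ (inj₂ refl)) sr with count≡2⇒⊆ (adj t) (degree t) (adj-sym ut) (adj-sym vt) (adj⇒≢ (adj-sym uv)) _ sr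
      ... | inj₁ r≡u = inj₁ r≡u
      ... | inj₂ r≡v = inj₂ (inj₁ r≡v)

      complete : ∀ {s r} → InT s → InT r → s ≢ r → adj s r ≡ true
      complete (inj₁ refl)        (inj₁ refl)        s≢r = ⊥-elim (s≢r refl)
      complete (inj₁ refl)        (inj₂ (inj₁ refl)) _   = uv
      complete (inj₁ refl)        (inj₂ (inj₂ refl)) _   = ut
      complete (inj₂ (inj₁ refl)) (inj₁ refl)        _   = adj-sym uv
      complete (inj₂ (inj₁ refl)) (inj₂ (inj₁ refl)) s≢r = ⊥-elim (s≢r refl)
      complete (inj₂ (inj₁ refl)) (inj₂ (inj₂ refl)) _   = vt
      complete (inj₂ (inj₂ refl)) (inj₁ refl)        _   = adj-sym ut
      complete (inj₂ (inj₂ refl)) (inj₂ (inj₁ refl)) _   = adj-sym vt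
      complete (inj₂ (inj₂ refl)) (inj₂ (inj₂ refl)) s≢r = ⊥-elim (s≢r refl)

      InT? : ∀ r → InT r ⊎ ¬ InT r
      InT? r with r ≟ u | r ≟ v | r ≟ t
      ... | yes r≡u | _       | _       = inj₁ (inj₁ r≡u)
      ... | no _    | yes r≡v | _       = inj₁ (inj₂ (inj₁ r≡v))
      ... | no _    | no _    | yes r≡t = inj₁ (inj₂ (inj₂ r≡t))
      ... | no r≢u  | no r≢v  | no r≢t  = inj₂ [ r≢u , [ r≢v , r≢t ] ]

      outside : (∃[ p ] ∃[ q ] (p ≢ q × ¬ Adj Γ p q)) → ∃ λ r → ¬ InT r
      outside (p , q , p≢q , p≁q) with InT? p | InT? q
      ... | inj₂ p∉T | _        = p , p∉T
      ... | inj₁ _   | inj₂ q∉T = q , q∉T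
      ... | inj₁ p∈T | inj₁ q∈T = ⊥-elim (p≁q (complete p∈T q∈T p≢q))

      unreachable : (∃ λ r → ¬ InT r) → ⊥
      unreachable (r , r∉T) with connected u r (λ u≡r → r∉T (inj₁ (sym u≡r)))
      ... | inj₁ ur               = r∉T (nbhd-in-T (inj₁ refl) ur)
      ... | inj₂ (w , uw , wr)    = r∉T (nbhd-in-T (nbhd-in-T (inj₁ refl) uw) wr)

    stronglyRegular : (∀ u v → u ≢ v → shared u v ≤ 1) → StronglyRegular Γ
    stronglyRegular shared≤1 = 2 , 0 , 1 , regular , adjacent , nonadjacent
      where
      adjacent : ∀ u v → Adj Γ u v → common Γ u v ≡ 0
      adjacent u v uv = trans (common≡shared u v) (count-false _ noCommon)
        where
        noCommon : ∀ t → adj u t ∧ adj v t ≡ false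
        noCommon t = ¬-not λ uvt → triangle-free uv (proj₁ (∧≡true uvt)) (proj₂ (∧≡true uvt))

      nonadjacent : ∀ u v → u ≢ v → ¬ Adj Γ u v → common Γ u v ≡ 1
      nonadjacent u v u≢v u≁v with connected u v u≢v
      ... | inj₁ uv = ⊥-elim (u≁v uv)
      ... | inj₂ (w , uw , wv) = trans (common≡shared u v)
        (≤-antisym (shared≤1 u v u≢v) (0<count (λ t → adj u t ∧ adj v t) (cong₂ _∧_ uw (adj-sym wv))))

  -- Otherwise adjacency inside N(x) would be a perfect matching of its three vertices.
  ¬three-neighbours-matched : ∀ x → count (adj x) ≡ 3 → ¬ (∀ s → adj x s ≡ true → shared s x ≡ 1)
  ¬three-neighbours-matched x deg≡3 matched =
    noThird (count-witness (adj x) (subst (0 <_) (sym deg≡3) (s≤s z≤n)))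
    where
    partner-unique : ∀ {s t t′} → adj x s ≡ true → adj s t ≡ true → adj x t ≡ true →
      adj s t′ ≡ true → adj x t′ ≡ true → t ≡ t′
    partner-unique {s} xs st xt st′ xt′ =
      count≡1⇒unique (λ r → adj s r ∧ adj x r) (matched s xs) (cong₂ _∧_ st′ xt′) (cong₂ _∧_ st xt)

    partner : ∀ {s} → adj x s ≡ true → ∃ λ t → adj s t ≡ true × adj x t ≡ true
    partner {s} xs with count≡1⇒∃! (λ r → adj s r ∧ adj x r) (matched s xs)
    ... | t , st∧xt , _ = t , ∧≡true st∧xt

    third : ∀ {s₀ s₁} → adj x s₀ ≡ true → adj x s₁ ≡ true → s₁ ≢ s₀ →
      ∃ λ s₂ → adj x s₂ ≡ true × s₂ ≢ s₀ × s₂ ≢ s₁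
    third {s₀} xs₀ xs₁ s₁≢s₀
      with 2≤count⇒another (adj x ∖ s₀) (≤-pred (subst (3 ≤_) (count-∖ (adj x) xs₀) (≤-reflexive (sym deg≡3))))
                           (∖-intro (adj x) xs₁ s₁≢s₀)
    ... | s₂ , x∖s₀s₂ , s₂≢s₁ = s₂ , proj₁ (∖-elim (adj x) x∖s₀s₂) , proj₂ (∖-elim (adj x) x∖s₀s₂) , s₂≢s₁

    noThird : (∃ λ s → adj x s ≡ true) → ⊥
    noThird (s₀ , xs₀) with partner xs₀
    ... | s₁ , s₀s₁ , xs₁ with third xs₀ xs₁ (adj⇒≢ (adj-sym s₀s₁))
    ... | s₂ , xs₂ , s₂≢s₀ , s₂≢s₁ with partner xs₂
    ... | t , s₂t , xt with count≡3⇒⊆ (adj x) deg≡3 xs₀ xs₁ xs₂ (adj⇒≢ (adj-sym s₀s₁)) s₂≢s₀ s₂≢s₁ t xt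
    ...   | inj₁ refl        = s₂≢s₁ (partner-unique xs₀ (adj-sym s₂t) xs₂ s₀s₁ xs₁)
    ...   | inj₂ (inj₁ refl) = s₂≢s₀ (partner-unique xs₁ (adj-sym s₂t) xs₂ (adj-sym s₀s₁) xs₀)
    ...   | inj₂ (inj₂ refl) = adj⇒≢ s₂t refl

-- Deza graphs with k = b + 1

module TwoLabels {n} {A : Set} {P : Fin n → Set} (f g : ∀ {u} → P u → A)
  (well-defined : ∀ {u} (p q : P u) → f p ≡ f q)
  (f-or-g : ∀ {u v} (p : P u) (q : P v) → u ≢ v → f p ≡ f q ⊎ g p ≡ g q)
  (¬f-and-g : ∀ {u v} (p : P u) (q : P v) → u ≢ v → f p ≡ f q → g p ≢ g q) where

  -- Two P-vertices with the same f-label force all f-labels to agree: a vertex agreeing with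
  -- both of them only in its g-label would make their g-labels agree as well.
  f-constant : ∀ {u₀ u₁} (p₀ : P u₀) (p₁ : P u₁) → u₁ ≢ u₀ → f p₀ ≡ f p₁ → ∀ {u} (p : P u) → f p ≡ f p₀
  f-constant {u₀} {u₁} p₀ p₁ u₁≢u₀ f₀≡f₁ {u} p with u ≟ u₀ | u ≟ u₁
  ... | yes refl | _        = well-defined p p₀
  ... | no _     | yes refl = trans (well-defined p p₁) (sym f₀≡f₁)
  ... | no u≢u₀  | no u≢u₁ with f-or-g p p₀ u≢u₀ | f-or-g p p₁ u≢u₁
  ...   | inj₁ f≡f₀ | _         = f≡f₀
  ...   | inj₂ _    | inj₁ f≡f₁ = trans f≡f₁ (sym f₀≡f₁)
  ...   | inj₂ g≡g₀ | inj₂ g≡g₁ = ⊥-elim (¬f-and-g p₀ p₁ (≢-sym u₁≢u₀) f₀≡f₁ (trans (sym g≡g₀) g≡g₁))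

module DezaValencyBPlusOne {n b a : ℕ} (Γ : Graph n) (regular : Regular Γ (suc b)) (a≤b : a ≤ b)
  (dichotomy : ∀ u v → u ≢ v → common Γ u v ≡ b ⊎ common Γ u v ≡ a) where
  open Graph Γ using (adj; irrefl)
  open GraphFacts Γ

  degree : ∀ v → count (adj v) ≡ suc b
  degree v = trans (sym (∣tabulate∣≡count (adj v))) (regular v)

  shared≡b⊎a : ∀ {u v} → u ≢ v → shared u v ≡ b ⊎ shared u v ≡ a
  shared≡b⊎a {u} {v} u≢v with dichotomy u v u≢v
  ... | inj₁ c≡b = inj₁ (trans (sym (common≡shared u v)) c≡b)
  ... | inj₂ c≡a = inj₂ (trans (sym (common≡shared u v)) c≡a)

  shared≤b : ∀ {u v} → u ≢ v → shared u v ≤ b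
  shared≤b u≢v with shared≡b⊎a u≢v
  ... | inj₁ s≡b = ≤-reflexive s≡b
  ... | inj₂ s≡a = ≤-trans (≤-reflexive s≡a) a≤b

  shared+∣∖N∣ : ∀ x u → shared x u + count (x ∖N u) ≡ suc b
  shared+∣∖N∣ x u = trans (sym (count-split (adj x) (adj u))) (degree x)

  nbhd-⊈ : ∀ {u v} → u ≢ v → ¬ (∀ w → adj u w ≡ true → adj v w ≡ true)
  nbhd-⊈ {u} {v} u≢v N⊆N = <-irrefl all-shared (s≤s (shared≤b u≢v))
    where
    all-shared : shared u v ≡ suc b
    all-shared = trans (count-cong λ w → ∧-implied (N⊆N w)) (degree u)

  _∈B_ : Fin n → Fin n → Set
  u ∈B x = inB Γ b x u ≡ true

  ∈B⇒ : ∀ {u x} → u ∈B x → u ≢ x × shared u x ≡ b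
  ∈B⇒ {u} {x} u∈Bx with u ≟ x | common Γ u x ℕ.≟ b
  ... | no u≢x | yes c≡b = u≢x , trans (sym (common≡shared u x)) c≡b

  ⇒∈B : ∀ {u x} → u ≢ x → shared u x ≡ b → u ∈B x
  ⇒∈B {u} {x} u≢x s≡b with u ≟ x | common Γ u x ℕ.≟ b
  ... | yes u≡x | _      = ⊥-elim (u≢x u≡x)
  ... | no _    | yes _  = refl
  ... | no _    | no c≢b = ⊥-elim (c≢b (trans (common≡shared u x) s≡b))

  ∈B-sym : ∀ {u x} → u ∈B x → x ∈B u
  ∈B-sym {u} {x} u∈Bx = ⇒∈B (≢-sym (proj₁ (∈B⇒ u∈Bx))) (trans (shared-comm x u) (proj₂ (∈B⇒ u∈Bx)))

  -- N(u) = N(x) − y + z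
  record Exchange (x u : Fin n) : Set where
    field
      y : Fin n
      lost : x ∖N u ≗ (_== y)
      z : Fin n
      gained : u ∖N x ≗ (_== z)

  differ-by-one : ∀ x u → shared x u ≡ b → ∃ λ y → x ∖N u ≗ (_== y)
  differ-by-one x u s≡b with count≡1⇒∃! (x ∖N u) ∣x∖Nu∣≡1
    where
    ∣x∖Nu∣≡1 : count (x ∖N u) ≡ 1
    ∣x∖Nu∣≡1 = +-cancelˡ-≡ b (count (x ∖N u)) 1 (begin
      b + count (x ∖N u)         ≡⟨ cong (_+ count (x ∖N u)) s≡b ⟨
      shared x u + count (x ∖N u) ≡⟨ shared+∣∖N∣ x u ⟩
      suc b                      ≡⟨ +-comm 1 b ⟩
      b + 1                      ∎)
      where open ≡-Reasoning
  ... | y , y∈x∖Nu , unique = y , unique⇒≗== (x ∖N u) y∈x∖Nu unique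

  exchange : ∀ {x u} → u ∈B x → Exchange x u
  exchange {x} {u} u∈Bx
    with differ-by-one x u (trans (shared-comm x u) (proj₂ (∈B⇒ u∈Bx)))
       | differ-by-one u x (proj₂ (∈B⇒ u∈Bx))
  ... | y , lost | z , gained = record { y = y ; lost = lost ; z = z ; gained = gained }

  swap : ∀ {x u} → Exchange x u → Exchange u x
  swap e = record { y = z ; lost = gained ; z = y ; gained = lost }
    where open Exchange e

  module _ {x u} (e : Exchange x u) where
    open Exchange e

    x~y : adj x y ≡ true
    x~y = proj₁ (∧-not≡true (trans (lost y) (==-refl y)))

    u≁y : adj u y ≡ false
    u≁y = proj₂ (∧-not≡true (trans (lost y) (==-refl y)))

    lost⇒≡y : ∀ {w} → (x ∖N u) w ≡ true → w ≡ y
    lost⇒≡y {w} w∈x∖Nu = ==⇒≡ (trans (sym (lost w)) w∈x∖Nu)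

    y-unique : ∀ {w} → adj x w ≡ true → adj u w ≡ false → w ≡ y
    y-unique xw uw = lost⇒≡y (∧-not-intro xw uw)

    kept : ∀ {w} → adj x w ≡ true → w ≢ y → adj u w ≡ true
    kept xw w≢y = ¬-not (w≢y ∘ y-unique xw)

    adj-u : ∀ {w} → adj u w ≡ true → (adj x w ≡ true × w ≢ y) ⊎ w ≡ z
    adj-u {w} uw with adj x w in xw
    ... | true  = inj₁ (refl , λ { refl → not-¬ uw u≁y })
    ... | false = inj₂ (==⇒≡ (trans (sym (gained w)) (cong₂ (λ s t → s ∧ not t) uw xw)))

  module _ {x u} (e : Exchange x u) where
    open Exchange e

    u~z : adj u z ≡ true
    u~z = x~y (swap e)

    x≁z : adj x z ≡ false
    x≁z = u≁y (swap e)

    gained⇒≡z : ∀ {w} → (u ∖N x) w ≡ true → w ≡ z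
    gained⇒≡z = lost⇒≡y (swap e)

    z-unique : ∀ {w} → adj u w ≡ true → adj x w ≡ false → w ≡ z
    z-unique = y-unique (swap e)

  module _ {x u} (u∈Bx : u ∈B x) where
    open Exchange (exchange u∈Bx)

    ∣x∖Nu∣≡1 : count (x ∖N u) ≡ 1
    ∣x∖Nu∣≡1 = trans (count-cong lost) (count-== y)

    ∣u∖Nx∣≡1 : count (u ∖N x) ≡ 1
    ∣u∖Nx∣≡1 = trans (count-cong gained) (count-== z)

    Nx─Nu≡⁅y⁆ : N Γ x ─ N Γ u ≡ ⁅ y ⁆
    Nx─Nu≡⁅y⁆ = trans (tabulate-─ (adj x) (adj u)) (tabulate≡⁅⁆ (x ∖N u) lost)

    Nu─Nx≡⁅z⁆ : N Γ u ─ N Γ x ≡ ⁅ z ⁆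
    Nu─Nx≡⁅z⁆ = trans (tabulate-─ (adj u) (adj x)) (tabulate≡⁅⁆ (u ∖N x) gained)

  module StrictlyDeza (diameter2 : Diameter2 Γ) (notSRG : ¬ StronglyRegular Γ) where

    a<b : a < b
    a<b with m≤n⇒m<n∨m≡n a≤b
    ... | inj₁ a<b  = a<b
    ... | inj₂ refl = ⊥-elim (notSRG (suc b , b , b , regular , (λ u v uv → all≡b (adj⇒≢ uv)) , λ u v u≢v _ → all≡b u≢v))
      where
      all≡b : ∀ {u v} → u ≢ v → common Γ u v ≡ b
      all≡b {u} {v} u≢v with dichotomy u v u≢v
      ... | inj₁ c≡b = c≡b
      ... | inj₂ c≡a = c≡a

    -- If a = b − 1, every vertex shares at least b − 1 neighbours with x₀, so a neighbour of x₀ has at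
    -- most one neighbour outside N[x₀] and the neighbourhoods of the remote vertices inside N(x₀)
    -- are pairwise disjoint.  Three remote vertices then overfill N(x₀) if b ≥ 3, and for b = 2 they
    -- force adjacency inside N(x₀) to be a perfect matching of its three vertices.
    module GapOne (b≤1+a : b ≤ suc a) (x₀ : Fin n) where

      b≤1+shared : ∀ {u v} → u ≢ v → b ≤ suc (shared u v)
      b≤1+shared u≢v with shared≡b⊎a u≢v
      ... | inj₁ s≡b = subst (λ s → b ≤ suc s) (sym s≡b) (n≤1+n b)
      ... | inj₂ s≡a = subst (λ s → b ≤ suc s) (sym s≡a) b≤1+a

      inner : Fin n → ℕ
      inner u = shared u x₀

      out : Fin n → Fin n → Bool
      out u = u ∖N x₀

      inner+∣out∣ : ∀ u → inner u + count (out u) ≡ suc b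
      inner+∣out∣ u = shared+∣∖N∣ u x₀

      ∣out∣≤2 : ∀ {w} → w ≢ x₀ → count (out w) ≤ 2
      ∣out∣≤2 {w} w≢x₀ = +-cancelˡ-≤ (inner w) (count (out w)) 2 (begin
        inner w + count (out w)  ≡⟨ inner+∣out∣ w ⟩
        suc b                    ≤⟨ s≤s (b≤1+shared w≢x₀) ⟩
        2 + inner w              ≡⟨ +-comm 2 (inner w) ⟩
        inner w + 2              ∎)
        where open ≤-Reasoning

      Remote : Fin n → Set
      Remote u = u ≢ x₀ × adj x₀ u ≡ false

      inside : Fin n → Fin n → Bool
      inside u t = adj u t ∧ adj x₀ t

      inside⊆N₀ : ∀ u t → inside u t ≡ true → adj x₀ t ≡ true
      inside⊆N₀ u t = proj₂ ∘ ∧≡true {adj u t}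

      -- A common neighbour t of x₀ and two remote vertices would have x₀ and both of them in out t.
      remote-disjoint : ∀ {u u′} → Remote u → Remote u′ → u′ ≢ u → ∀ t → inside u t ∧ inside u′ t ≡ false
      remote-disjoint {u} {u′} (u≢x₀ , x₀≁u) (u′≢x₀ , x₀≁u′) u′≢u t = ¬-not λ both →
        let ut , x₀t = ∧≡true {adj u t} (proj₁ (∧≡true {inside u t} both))
            u′t , _  = ∧≡true {adj u′ t} (proj₂ (∧≡true {inside u t} both))
        in  <-irrefl refl (≤-trans (3≤count (out t) (∧-not-intro (adj-sym x₀t) (irrefl x₀))
                                                    (∧-not-intro (adj-sym ut) x₀≁u)
                                                    (∧-not-intro (adj-sym u′t) x₀≁u′)
                                                    u≢x₀ u′≢x₀ u′≢u)
                                   (∣out∣≤2 (adj⇒≢ (adj-sym x₀t))))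

      inner-pair≤ : ∀ {u u′} → Remote u → Remote u′ → u′ ≢ u → inner u + inner u′ ≤ suc b
      inner-pair≤ {u} {u′} ru ru′ u′≢u = subst (inner u + inner u′ ≤_) (degree x₀)
        (count-disjoint-≤ (inside u) (inside u′) (adj x₀) (remote-disjoint ru ru′ u′≢u) (inside⊆N₀ u) (inside⊆N₀ u′))

      inner-triple≤ : ∀ {u u′ u″} → Remote u → Remote u′ → Remote u″ → u′ ≢ u → u″ ≢ u → u″ ≢ u′ →
        inner u + inner u′ + inner u″ ≤ suc b
      inner-triple≤ {u} {u′} {u″} ru ru′ ru″ u′≢u u″≢u u″≢u′ = subst (inner u + inner u′ + inner u″ ≤_) (degree x₀)
        (count-disjoint₃-≤ (inside u) (inside u′) (inside u″) (adj x₀)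
          (remote-disjoint ru ru′ u′≢u) (remote-disjoint ru ru″ u″≢u) (remote-disjoint ru′ ru″ u″≢u′)
          (inside⊆N₀ u) (inside⊆N₀ u′) (inside⊆N₀ u″))

      remote-step : ∀ {u t} → Remote u → out u t ≡ true → Remote t × t ≢ u
      remote-step {u} {t} (_ , x₀≁u) ut∧x₀≁t = (t≢x₀ , x₀≁t) , ≢-sym (adj⇒≢ ut)
        where
        ut = proj₁ (∧-not≡true ut∧x₀≁t)
        x₀≁t = proj₂ (∧-not≡true ut∧x₀≁t)
        t≢x₀ : t ≢ x₀
        t≢x₀ refl = not-¬ (adj-sym ut) x₀≁u

      0<∣out∣ : ∀ {u} → Remote u → 0 < count (out u)
      0<∣out∣ {u} (u≢x₀ , _) = +-cancelˡ-≤-by (≤-reflexive (trans (+-comm b 1) (sym (inner+∣out∣ u)))) (shared≤b u≢x₀)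

      record RemoteTriple : Set where
        constructor remoteTriple
        field
          u₀ u₁ u₂ : Fin n
          remote₀ : Remote u₀
          remote₁ : Remote u₁
          remote₂ : Remote u₂
          u₁≢u₀ : u₁ ≢ u₀
          u₂≢u₀ : u₂ ≢ u₀
          u₂≢u₁ : u₂ ≢ u₁

      three-remote : 2 ≤ b → ∀ {u₀} → Remote u₀ → RemoteTriple
      three-remote 2≤b {u₀} r₀ with count-witness (out u₀) (0<∣out∣ r₀)
      ... | u₁ , o₀₁ = extend (remote-step r₀ o₀₁) (2 ≤? count (out u₀))
        where
        -- If u₀ has a single neighbour outside N(x₀), then u₀ shares b neighbours with x₀ and u₁ at most one.
        2≤∣out₁∣ : ¬ 2 ≤ count (out u₀) → 2 ≤ count (out u₁)
        2≤∣out₁∣ 2≰o₀ = ≤-trans 2≤b (+-cancelˡ-≤-by (≤-reflexive (sym (inner+∣out∣ u₁))) inner₁≤1)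
          where
          b≤inner₀ : b ≤ inner u₀
          b≤inner₀ = +-cancelʳ-≤-by (≤-reflexive (trans (+-comm b 1) (sym (inner+∣out∣ u₀)))) (≤-pred (≰⇒> 2≰o₀))
          inner₁≤1 : inner u₁ ≤ 1
          inner₁≤1 = +-cancelˡ-≤-by (≤-trans (inner-pair≤ r₀ (proj₁ (remote-step r₀ o₀₁)) (proj₂ (remote-step r₀ o₀₁)))
                                             (≤-reflexive (+-comm 1 b))) b≤inner₀

        extend : Remote u₁ × u₁ ≢ u₀ → Dec (2 ≤ count (out u₀)) → RemoteTriple
        extend (r₁ , u₁≢u₀) (yes 2≤o₀) with 2≤count⇒another (out u₀) 2≤o₀ o₀₁
        ... | u₂ , o₀₂ , u₂≢u₁ = remoteTriple u₀ u₁ u₂ r₀ r₁ (proj₁ (remote-step r₀ o₀₂)) u₁≢u₀ (proj₂ (remote-step r₀ o₀₂)) u₂≢u₁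
        extend (r₁ , u₁≢u₀) (no 2≰o₀)
          with 2≤count⇒another (out u₁) (2≤∣out₁∣ 2≰o₀) (∧-not-intro (adj-sym (proj₁ (∧-not≡true o₀₁))) (proj₂ r₀))
        ... | u₂ , o₁₂ , u₂≢u₀ = remoteTriple u₀ u₁ u₂ r₀ r₁ (proj₁ (remote-step r₁ o₁₂)) u₁≢u₀ u₂≢u₀ (proj₂ (remote-step r₁ o₁₂))

      ¬3≤b : 3 ≤ b → ∀ {u} → Remote u → ⊥
      ¬3≤b 3≤b r with three-remote (≤-trans (n≤1+n 2) 3≤b) r
      ... | remoteTriple u₀ u₁ u₂ r₀ r₁ r₂ u₁≢u₀ u₂≢u₀ u₂≢u₁ =
        ¬three-large 3≤b (inner-triple≤ r₀ r₁ r₂ u₁≢u₀ u₂≢u₀ u₂≢u₁)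
          (b≤1+shared (proj₁ r₀)) (b≤1+shared (proj₁ r₁)) (b≤1+shared (proj₁ r₂))

      module _ (b≡2 : b ≡ 2) where

        1≤inner : ∀ {u} → u ≢ x₀ → 1 ≤ inner u
        1≤inner {u} u≢x₀ = ≤-pred (subst (_≤ suc (inner u)) b≡2 (b≤1+shared u≢x₀))

        inner≡1 : ∀ {s u} → adj x₀ s ≡ true → Remote u → adj u s ≡ true → inner s ≡ 1
        inner≡1 {s} x₀s (u≢x₀ , x₀≁u) us = ≤-antisym
          (+-cancelʳ-≤-by (≤-reflexive (trans (inner+∣out∣ s) (cong suc b≡2)))
                         (2≤count (out s) (∧-not-intro (adj-sym x₀s) (irrefl x₀)) (∧-not-intro (adj-sym us) x₀≁u) u≢x₀))
          (1≤inner (adj⇒≢ (adj-sym x₀s)))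

        ¬remote : ∀ {u} → Remote u → ⊥
        ¬remote r with three-remote (≤-reflexive (sym b≡2)) r
        ... | remoteTriple u₀ u₁ u₂ r₀ r₁ r₂ u₁≢u₀ u₂≢u₀ u₂≢u₁
          with count-witness (inside u₀) (1≤inner (proj₁ r₀)) | count-witness (inside u₁) (1≤inner (proj₁ r₁))
             | count-witness (inside u₂) (1≤inner (proj₁ r₂))
        ... | a₀ , A₀ | a₁ , A₁ | a₂ , A₂ =
          ¬three-neighbours-matched x₀ (trans (degree x₀) (cong suc b≡2)) matched
          where
          distinct : ∀ {u u′ t t′} → Remote u → Remote u′ → u′ ≢ u → inside u t ≡ true → inside u′ t′ ≡ true → t′ ≢ t
          distinct {u} {u′} {t} r r′ u′≢u At A′t′ refl =
            not-¬ (cong₂ _∧_ At A′t′) (remote-disjoint r r′ u′≢u t)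
          matched : ∀ s → adj x₀ s ≡ true → shared s x₀ ≡ 1
          matched s x₀s with count≡3⇒⊆ (adj x₀) (trans (degree x₀) (cong suc b≡2))
                               (inside⊆N₀ u₀ a₀ A₀) (inside⊆N₀ u₁ a₁ A₁) (inside⊆N₀ u₂ a₂ A₂)
                               (distinct r₀ r₁ u₁≢u₀ A₀ A₁) (distinct r₀ r₂ u₂≢u₀ A₀ A₂) (distinct r₁ r₂ u₂≢u₁ A₁ A₂) s x₀s
          ... | inj₁ refl        = inner≡1 x₀s r₀ (proj₁ (∧≡true A₀))
          ... | inj₂ (inj₁ refl) = inner≡1 x₀s r₁ (proj₁ (∧≡true A₁))
          ... | inj₂ (inj₂ refl) = inner≡1 x₀s r₂ (proj₁ (∧≡true A₂))

    ¬b≤1+a : ¬ b ≤ suc a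
    ¬b≤1+a b≤1+a = excluded b refl (proj₂ diameter2)
      where
      open GapOne b≤1+a
      excluded : ∀ m → m ≡ b → (∃[ x₀ ] ∃[ u₀ ] (x₀ ≢ u₀ × ¬ Adj Γ x₀ u₀)) → ⊥
      excluded zero                0≡b _ = n≮0 (subst (a <_) (sym 0≡b) a<b)
      excluded (suc zero)          1≡b _ = notSRG (stronglyRegular (subst (Regular Γ ∘ suc) (sym 1≡b) regular)
        diameter2 (λ u v u≢v → subst (shared u v ≤_) (sym 1≡b) (shared≤b u≢v)))
      excluded (suc (suc zero))    2≡b (x₀ , u₀ , x₀≢u₀ , x₀≁u₀) =
        ¬remote x₀ (sym 2≡b) (≢-sym x₀≢u₀ , ¬-not x₀≁u₀)
      excluded (suc (suc (suc _))) 3+≡b (x₀ , u₀ , x₀≢u₀ , x₀≁u₀) =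
        ¬3≤b x₀ (subst (3 ≤_) 3+≡b (s≤s (s≤s (s≤s z≤n)))) (≢-sym x₀≢u₀ , ¬-not x₀≁u₀)

    module _ {x u v} (eu : Exchange x u) (ev : Exchange x v) (u≢v : u ≢ v) where
      private
        module U = Exchange eu
        module V = Exchange ev

      -- N(x) ⊆ (N(u) ∩ N(v)) ∪ {y_u, y_v}, so u and v share at least b − 1 = a neighbours; a is excluded.
      shared≡b : shared u v ≡ b
      shared≡b with shared≡b⊎a u≢v
      ... | inj₁ s≡b = s≡b
      ... | inj₂ s≡a = ⊥-elim (¬b≤1+a (subst (λ s → b ≤ suc s) s≡a (≤-pred (begin
        suc b                 ≡⟨ degree x ⟨
        count (adj x)         ≤⟨ count≤+2 (adj x) (λ w → adj u w ∧ adj v w) U.y V.y covered ⟩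
        shared u v + 2      ≡⟨ +-comm (shared u v) 2 ⟩
        suc (suc (shared u v)) ∎))))
        where
        open ≤-Reasoning
        covered : ∀ w → adj x w ≡ true → adj u w ∧ adj v w ≡ true ⊎ w ≡ U.y ⊎ w ≡ V.y
        covered w xw with w ≟ U.y | w ≟ V.y
        ... | yes w≡yu | _        = inj₂ (inj₁ w≡yu)
        ... | no _     | yes w≡yv = inj₂ (inj₂ w≡yv)
        ... | no w≢yu  | no w≢yv  = inj₁ (cong₂ _∧_ (kept eu xw w≢yu) (kept ev xw w≢yv))

      -- Equal exchanges would give N(u) ⊆ N(v).
      ¬same-exchange : U.y ≡ V.y → U.z ≢ V.z
      ¬same-exchange yu≡yv zu≡zv = nbhd-⊈ u≢v Nu⊆Nv
        where
        Nu⊆Nv : ∀ w → adj u w ≡ true → adj v w ≡ true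
        Nu⊆Nv w uw with adj-u eu uw
        ... | inj₁ (xw , w≢yu) = kept ev xw (w≢yu ∘ (λ w≡yv → trans w≡yv (sym yu≡yv)))
        ... | inj₂ refl        = subst (λ t → adj v t ≡ true) (sym zu≡zv) (u~z ev)

      -- Otherwise N(u) ∩ N(v) ⊆ N(x) ∖ {y_u, y_v}, which has only b − 1 elements.
      same-y-or-z : U.y ≡ V.y ⊎ U.z ≡ V.z
      same-y-or-z with U.y ≟ V.y | U.z ≟ V.z
      ... | yes yu≡yv | _         = inj₁ yu≡yv
      ... | no _      | yes zu≡zv = inj₂ zu≡zv
      ... | no yu≢yv  | no zu≢zv  = ⊥-elim (<-irrefl shared≡b (≤-pred (begin-strict
        suc (shared u v)                          ≤⟨ s≤s (count-mono inside) ⟩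
        suc (count ((adj x ∖ U.y) ∖ V.y))           <⟨ n<1+n _ ⟩
        suc (suc (count ((adj x ∖ U.y) ∖ V.y)))     ≡⟨ cong suc (count-∖ (adj x ∖ U.y) (∖-intro (adj x) (x~y ev) (≢-sym yu≢yv))) ⟨
        suc (count (adj x ∖ U.y))                   ≡⟨ count-∖ (adj x) (x~y eu) ⟨
        count (adj x)                               ≡⟨ degree x ⟩
        suc b                                       ∎)))
        where
        open ≤-Reasoning
        inside : ∀ w → adj u w ∧ adj v w ≡ true → ((adj x ∖ U.y) ∖ V.y) w ≡ true
        inside w uw∧vw with ∧≡true {adj u w} uw∧vw
        ... | uw , vw with adj-u eu uw | adj-u ev vw
        ... | inj₁ (xw , w≢yu) | inj₁ (_ , w≢yv) = ∖-intro (adj x ∖ U.y) (∖-intro (adj x) xw w≢yu) w≢yv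
        ... | inj₁ (xw , _)    | inj₂ refl        = ⊥-elim (not-¬ xw (x≁z ev))
        ... | inj₂ refl        | inj₁ (xw , _)    = ⊥-elim (not-¬ xw (x≁z eu))
        ... | inj₂ refl        | inj₂ zu≡zv       = ⊥-elim (zu≢zv zu≡zv)

    CommonY : Fin n → Fin n → Set
    CommonY x y = adj x y ≡ true × (∀ u → u ∈B x → adj u y ≡ false)

    CommonZ : Fin n → Fin n → Set
    CommonZ x z = adj x z ≡ false × (∀ u → u ∈B x → adj u z ≡ true)

    module _ (x : Fin n) where
      private
        yOf zOf : ∀ {u} → u ∈B x → Fin n
        yOf p = Exchange.y (exchange p)
        zOf p = Exchange.z (exchange p)

        same-y-or-z′ : ∀ {u v} (p : u ∈B x) (q : v ∈B x) → u ≢ v → yOf p ≡ yOf q ⊎ zOf p ≡ zOf q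
        same-y-or-z′ p q = same-y-or-z (exchange p) (exchange q)

      module SameY = TwoLabels yOf zOf
        (λ p q → y-unique (exchange q) (x~y (exchange p)) (u≁y (exchange p)))
        same-y-or-z′
        (λ p q → ¬same-exchange (exchange p) (exchange q))

      module SameZ = TwoLabels zOf yOf
        (λ p q → z-unique (exchange q) (u~z (exchange p)) (x≁z (exchange p)))
        (λ p q u≢v → Sum.swap (same-y-or-z′ p q u≢v))
        (λ p q u≢v z≡z y≡y → ¬same-exchange (exchange p) (exchange q) u≢v y≡y z≡z)

      CommonY⊎CommonZ : ∀ {u₀ u₁} → u₀ ∈B x → u₁ ∈B x → u₁ ≢ u₀ → (∃ λ y → CommonY x y) ⊎ (∃ λ z → CommonZ x z)
      CommonY⊎CommonZ p₀ p₁ u₁≢u₀ with same-y-or-z′ p₀ p₁ (≢-sym u₁≢u₀)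
      ... | inj₁ y₀≡y₁ = inj₁ (yOf p₀ , x~y (exchange p₀) ,
        λ u p → subst (λ t → adj u t ≡ false) (SameY.f-constant p₀ p₁ u₁≢u₀ y₀≡y₁ p) (u≁y (exchange p)))
      ... | inj₂ z₀≡z₁ = inj₂ (zOf p₀ , x≁z (exchange p₀) ,
        λ u p → subst (λ t → adj u t ≡ true) (SameZ.f-constant p₀ p₁ u₁≢u₀ z₀≡z₁ p) (u~z (exchange p)))

    module _ {x : Fin n} where

      B∩N : Fin n → Bool
      B∩N u = inB Γ b x u ∧ adj x u

      ∣B∩N∣≡0⇒typeA : count B∩N ≡ 0 → TypeA Γ b x
      ∣B∩N∣≡0⇒typeA none u u∈Bx xu = count≡0 B∩N none (cong₂ _∧_ (∈tabulate⇒ u∈Bx) xu)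

      B∩N⊆⁅y⁆⇒typeC : ∀ {y u} → (∀ v → B∩N v ≡ true → v ≡ y) → B∩N u ≡ true → TypeC Γ b x
      B∩N⊆⁅y⁆⇒typeC {y} only-y u∈B∩N = begin
        ∣ B Γ b x ∩ N Γ x ∣  ≡⟨ cong ∣_∣ (tabulate-∩ (inB Γ b x) (adj x)) ⟩
        ∣ tabulate B∩N ∣     ≡⟨ cong ∣_∣ (tabulate≡⁅⁆ B∩N (unique⇒≗== B∩N (subst (λ v → B∩N v ≡ true) (only-y _ u∈B∩N) u∈B∩N) only-y)) ⟩
        ∣ ⁅ y ⁆ ∣            ≡⟨ ∣⁅x⁆∣≡1 y ⟩
        1                    ∎
        where open ≡-Reasoning

      ∣⋃∣≡∣B∣ : (S : Fin n → Fin n → Bool) → (∀ u → u ∈B x → count (S u) ≡ 1) →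
        (∀ u v w → u ∈B x → v ∈B x → S u w ≡ true → S v w ≡ true → u ≡ v) →
        ∣ tabulate (λ w → any (λ u → inB Γ b x u ∧ S u w) (allFin n)) ∣ ≡ ∣ B Γ b x ∣
      ∣⋃∣≡∣B∣ S singleton disjoint =
        trans (∣tabulate∣≡count (λ w → any (λ u → inB Γ b x u ∧ S u w) (allFin n)))
          (trans (count-⋃-singletons (inB Γ b x) S singleton disjoint) (sym (∣tabulate∣≡count (inB Γ b x))))

      commonY⇒y≡ : ∀ {y u} → CommonY x y → (u∈Bx : u ∈B x) → Exchange.y (exchange u∈Bx) ≡ y
      commonY⇒y≡ {u = u} (xy , B≁y) u∈Bx = sym (y-unique (exchange u∈Bx) xy (B≁y u u∈Bx))

      commonZ⇒z≡ : ∀ {z u} → CommonZ x z → (u∈Bx : u ∈B x) → Exchange.z (exchange u∈Bx) ≡ z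
      commonZ⇒z≡ {u = u} (x≁z , B~z) u∈Bx = sym (z-unique (exchange u∈Bx) (B~z u u∈Bx) x≁z)

      commonY⇒typeA1⊎typeC : ∀ {y u₀} → u₀ ∈B x → CommonY x y → TypeA1 Γ b x ⊎ TypeC Γ b x
      commonY⇒typeA1⊎typeC {y} {u₀} u₀∈Bx commonY@(xy , _) with count B∩N in ∣B∩N∣
      ... | zero  = inj₁ (∣B∩N∣≡0⇒typeA ∣B∩N∣ , (y , witness , unique) , ∣⋃∣≡∣B∣ (_∖N x) (λ _ → ∣u∖Nx∣≡1) disjoint)
        where
        Nx─Nu≡⁅y⁆′ : ∀ {u} (u∈Bx : u ∈B x) → N Γ x ─ N Γ u ≡ ⁅ y ⁆
        Nx─Nu≡⁅y⁆′ u∈Bx = trans (Nx─Nu≡⁅y⁆ u∈Bx) (cong ⁅_⁆ (commonY⇒y≡ commonY u∈Bx))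
        witness : A1wit Γ b x y
        witness = xy , λ u u∈Bx → Nx─Nu≡⁅y⁆′ (∈tabulate⇒ u∈Bx)
        unique : ∀ y′ → A1wit Γ b x y′ → y′ ≡ y
        unique y′ (_ , N─N≡⁅y′⁆) = ⁅⁆-injective (trans (sym (N─N≡⁅y′⁆ u₀ (⇒∈tabulate u₀∈Bx))) (Nx─Nu≡⁅y⁆′ u₀∈Bx))
        disjoint : ∀ u v w → u ∈B x → v ∈B x → (u ∖N x) w ≡ true → (v ∖N x) w ≡ true → u ≡ v
        disjoint u v w u∈Bx v∈Bx uw vw with u ≟ v
        ... | yes u≡v = u≡v
        ... | no u≢v  = ⊥-elim (¬same-exchange (exchange u∈Bx) (exchange v∈Bx) u≢v
          (trans (commonY⇒y≡ commonY u∈Bx) (sym (commonY⇒y≡ commonY v∈Bx)))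
          (trans (sym (gained⇒≡z (exchange u∈Bx) uw)) (gained⇒≡z (exchange v∈Bx) vw)))
      ... | suc _ with count-witness B∩N (subst (0 <_) (sym ∣B∩N∣) (s≤s z≤n))
      ...   | _ , u∈B∩N = inj₂ (B∩N⊆⁅y⁆⇒typeC only-y u∈B∩N)
        where
        only-y : ∀ u → B∩N u ≡ true → u ≡ y
        only-y u u∈B∩N with ∧≡true {inB Γ b x u} u∈B∩N
        ... | u∈Bx , xu = trans (y-unique (exchange u∈Bx) xu (irrefl u)) (commonY⇒y≡ commonY u∈Bx)

      commonZ⇒typeA2⊎typeB : ∀ {z u₀} → u₀ ∈B x → CommonZ x z → TypeA2 Γ b x ⊎ TypeB Γ b x
      commonZ⇒typeA2⊎typeB {z} {u₀} u₀∈Bx commonZ@(x≁z , B~z) with count B∩N in ∣B∩N∣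
      ... | zero  = inj₁ (typeA , (z , witness , unique) , ∣⋃∣≡∣B∣ (x ∖N_) (λ _ → ∣x∖Nu∣≡1) disjoint)
        where
        typeA = ∣B∩N∣≡0⇒typeA ∣B∩N∣
        x≢z : x ≢ z
        x≢z refl = typeA u₀ (⇒∈tabulate u₀∈Bx) (adj-sym (B~z u₀ u₀∈Bx))
        distance2 : Dist2 Γ b x z
        distance2 with proj₁ diameter2 x z x≢z
        ... | inj₁ xz   = ⊥-elim (not-¬ xz x≁z)
        ... | inj₂ path = x≢z , (λ xz → not-¬ xz x≁z) , path
        Nu─Nx≡⁅z⁆′ : ∀ {u} (u∈Bx : u ∈B x) → N Γ u ─ N Γ x ≡ ⁅ z ⁆
        Nu─Nx≡⁅z⁆′ u∈Bx = trans (Nu─Nx≡⁅z⁆ u∈Bx) (cong ⁅_⁆ (commonZ⇒z≡ commonZ u∈Bx))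
        witness : A2wit Γ b x z
        witness = distance2 , λ u u∈Bx → Nu─Nx≡⁅z⁆′ (∈tabulate⇒ u∈Bx)
        unique : ∀ z′ → A2wit Γ b x z′ → z′ ≡ z
        unique z′ (_ , N─N≡⁅z′⁆) = ⁅⁆-injective (trans (sym (N─N≡⁅z′⁆ u₀ (⇒∈tabulate u₀∈Bx))) (Nu─Nx≡⁅z⁆′ u₀∈Bx))
        disjoint : ∀ u v w → u ∈B x → v ∈B x → (x ∖N u) w ≡ true → (x ∖N v) w ≡ true → u ≡ v
        disjoint u v w u∈Bx v∈Bx uw vw with u ≟ v
        ... | yes u≡v = u≡v
        ... | no u≢v  = ⊥-elim (¬same-exchange (exchange u∈Bx) (exchange v∈Bx) u≢v
          (trans (sym (lost⇒≡y (exchange u∈Bx) uw)) (lost⇒≡y (exchange v∈Bx) vw))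
          (trans (commonZ⇒z≡ commonZ u∈Bx) (sym (commonZ⇒z≡ commonZ v∈Bx))))
      ... | suc _ with count-witness B∩N (subst (0 <_) (sym ∣B∩N∣) (s≤s z≤n))
      ...   | u , u∈B∩N with ∧≡true {inB Γ b x u} u∈B∩N
      ...     | u∈Bx , xu = inj₂ λ {v} v∈Bx → ⇒∈tabulate (adj-sym (subst (λ t → adj v t ≡ true) z≡x (B~z v (∈tabulate⇒ v∈Bx))))
        where
        -- x ∈ N(u) ∖ N(x), so x is the vertex gained by u
        z≡x : z ≡ x
        z≡x = trans (sym (commonZ⇒z≡ commonZ u∈Bx)) (sym (z-unique (exchange u∈Bx) (adj-sym xu) (irrefl x)))

    β : Fin n → ℕ
    β v = count (inB Γ b v)

    class : Fin n → Fin n → Bool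
    class v u = u == v ∨ inB Γ b v u

    private
      γ : Fin n → ℕ
      γ v = count (not ∘ class v)

      ∣class∣≡1+β : ∀ v → count (class v) ≡ suc (β v)
      ∣class∣≡1+β v = trans (count-∨ (_== v) (inB Γ b v) disjoint) (cong (_+ β v) (count-== v))
        where
        disjoint : ∀ u → u == v ∧ inB Γ b v u ≡ false
        disjoint u with u == v
        ... | false = refl
        ... | true  = refl

      1+β+γ≡n : ∀ v → suc (β v + γ v) ≡ n
      1+β+γ≡n v = trans (cong (_+ γ v) (sym (∣class∣≡1+β v))) (count-complement (class v))

      shared-by-class : ∀ v u → shared v u ≡
        suc b * indicator (u == v) + b * indicator (inB Γ b v u) + a * indicator (not (u == v ∨ inB Γ b v u))
      shared-by-class v u with u ≟ v
      ... | yes refl = trans (count-cong (λ w → ∧-idem (adj v w))) (trans (degree v) (sym (select₁ (suc b) b a)))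
      ... | no u≢v with common Γ u v ℕ.≟ b
      ...   | yes c≡b = trans (trans (shared-comm v u) (trans (sym (common≡shared u v)) c≡b)) (sym (select₂ (suc b) b a))
      ...   | no c≢b with shared≡b⊎a (≢-sym u≢v)
      ...     | inj₁ s≡b = ⊥-elim (c≢b (trans (common≡shared u v) (trans (shared-comm u v) s≡b)))
      ...     | inj₂ s≡a = trans s≡a (sym (select₃ (suc b) b a))

      ∑shared≡k² : ∀ v → sum (shared v) ≡ suc b * suc b
      ∑shared≡k² v = begin
        sum (λ u → sum (λ w → indicator (adj v w ∧ adj u w)))  ≡⟨ ∑-comm (λ u w → indicator (adj v w ∧ adj u w)) ⟩
        sum (λ w → sum (λ u → indicator (adj v w ∧ adj u w)))  ≡⟨ sum-cong-≗ column ⟩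
        sum (λ w → suc b * indicator (adj v w))                ≡⟨ ∑-scaled (suc b) (adj v) ⟩
        suc b * count (adj v)                                  ≡⟨ cong (suc b *_) (degree v) ⟩
        suc b * suc b                                          ∎
        where
        open ≡-Reasoning
        column : ∀ w → count (λ u → adj v w ∧ adj u w) ≡ suc b * indicator (adj v w)
        column w with adj v w
        ... | true  = trans (count-cong (λ u → Graph.sym Γ u w)) (trans (degree w) (sym (*-identityʳ (suc b))))
        ... | false = trans (count-false {n} (λ _ → false) (λ _ → refl)) (sym (*-zeroʳ (suc b)))

      ∑shared≡k+bβ+aγ : ∀ v → sum (shared v) ≡ suc b + b * β v + a * γ v
      ∑shared≡k+bβ+aγ v = begin
        sum (shared v)
          ≡⟨ sum-cong-≗ (shared-by-class v) ⟩
        sum (λ u → suc b * indicator (u == v) + b * indicator (inB Γ b v u) + a * indicator (not (class v u)))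
          ≡⟨ ∑-distrib-+₃ (λ u → suc b * indicator (u == v)) (λ u → b * indicator (inB Γ b v u)) (λ u → a * indicator (not (class v u))) ⟩
        sum (λ u → suc b * indicator (u == v)) + sum (λ u → b * indicator (inB Γ b v u)) + sum (λ u → a * indicator (not (class v u)))
          ≡⟨ cong₂ _+_ (cong₂ _+_ (∑-scaled (suc b) (_== v)) (∑-scaled b (inB Γ b v))) (∑-scaled a (not ∘ class v)) ⟩
        suc b * count (_== v) + b * β v + a * γ v
          ≡⟨ cong (λ t → t + b * β v + a * γ v) (trans (cong (suc b *_) (count-== v)) (*-identityʳ (suc b))) ⟩
        suc b + b * β v + a * γ v
          ∎
        where open ≡-Reasoning

    β-constant : ∀ v w → β v ≡ β w
    β-constant v w = weights-cancel a<b
      (suc-injective (trans (1+β+γ≡n v) (sym (1+β+γ≡n w))))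
      (+-cancelˡ-≡ (suc b) _ _ (begin
        suc b + (b * β v + a * γ v)  ≡⟨ +-assoc (suc b) _ _ ⟨
        suc b + b * β v + a * γ v    ≡⟨ ∑shared≡k+bβ+aγ v ⟨
        sum (shared v)             ≡⟨ trans (∑shared≡k² v) (sym (∑shared≡k² w)) ⟩
        sum (shared w)             ≡⟨ ∑shared≡k+bβ+aγ w ⟩
        suc b + b * β w + a * γ w    ≡⟨ +-assoc (suc b) _ _ ⟩
        suc b + (b * β w + a * γ w)  ∎))
      where open ≡-Reasoning

    ∈B-trans : ∀ {x u v} → u ∈B x → v ∈B x → u ≢ v → v ∈B u
    ∈B-trans {x} {u} {v} u∈Bx v∈Bx u≢v =
      ⇒∈B (≢-sym u≢v) (trans (shared-comm v u) (shared≡b (exchange u∈Bx) (exchange v∈Bx) u≢v))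

    class-refl : ∀ v → class v v ≡ true
    class-refl v = cong (_∨ inB Γ b v v) (==-refl v)

    class-sym : ∀ {u v} → class u v ≡ true → class v u ≡ true
    class-sym {u} {v} uv with ∨≡true {v == u} uv
    ... | inj₁ v==u rewrite ==⇒≡ v==u = class-refl u
    ... | inj₂ v∈Bu = ∨-introʳ (∈B-sym v∈Bu)

    class-trans : ∀ {u v w} → class u v ≡ true → class v w ≡ true → class u w ≡ true
    class-trans {u} {v} {w} uv vw with ∨≡true {v == u} uv | ∨≡true {w == v} vw
    ... | inj₁ v==u | _         rewrite ==⇒≡ v==u = vw
    ... | inj₂ _    | inj₁ w==v rewrite ==⇒≡ w==v = uv
    ... | inj₂ v∈Bu | inj₂ w∈Bv = related (w ≟ u)
      where
      related : Dec (w ≡ u) → class u w ≡ true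
      related (yes refl) = class-refl w
      related (no w≢u)   = ∨-introʳ (∈B-trans (∈B-sym v∈Bu) w∈Bv (≢-sym w≢u))

    class-closed⇒β+1∣ : ∀ r (S : Fin n → Bool) → Closed class S → suc (β r) ∣ count S
    class-closed⇒β+1∣ r = closed⇒s∣ class (suc (β r)) class-refl (λ {u} {v} → class-sym {u} {v})
      (λ {u} {v} {w} → class-trans {u} {v} {w}) (λ v → trans (∣class∣≡1+β v) (cong suc (β-constant v r)))

    module CommonYClosed {x y u₀ u₁} (commonY : CommonY x y) (u₀∈Bx : u₀ ∈B x) (u₁∈Bx : u₁ ∈B x) (u₁≢u₀ : u₁ ≢ u₀) where
      private
        xy = proj₁ commonY
        B≁y = proj₂ commonY

      M : Fin n → Bool
      M = adj x ∖ y

      ∣M∣≡b : count M ≡ b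
      ∣M∣≡b = suc-injective (trans (sym (count-∖ (adj x) xy)) (degree x))

      M⊆N : ∀ {u w} → u ∈B x → M w ≡ true → adj u w ≡ true
      M⊆N u∈Bx Mw = kept (exchange u∈Bx) (proj₁ (∖-elim (adj x) Mw))
        (λ w≡yᵤ → proj₂ (∖-elim (adj x) Mw) (trans w≡yᵤ (commonY⇒y≡ commonY u∈Bx)))

      N∩N⊆M : ∀ {u w} → u ∈B x → adj x w ≡ true → adj u w ≡ true → M w ≡ true
      N∩N⊆M {u} u∈Bx xw uw = ∖-intro (adj x) xw λ { refl → not-¬ uw (B≁y u u∈Bx) }

      N∩N⊆M′ : ∀ {w} → adj u₀ w ≡ true → adj u₁ w ≡ true → M w ≡ true
      N∩N⊆M′ {w} u₀w u₁w with adj-u (exchange u₀∈Bx) u₀w | adj-u (exchange u₁∈Bx) u₁w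
      ... | inj₁ (xw , _) | _              = N∩N⊆M u₀∈Bx xw u₀w
      ... | inj₂ _        | inj₁ (xw , _)  = N∩N⊆M u₁∈Bx xw u₁w
      ... | inj₂ w≡z₀     | inj₂ w≡z₁      = ⊥-elim (¬same-exchange (exchange u₀∈Bx) (exchange u₁∈Bx) (≢-sym u₁≢u₀)
        (trans (commonY⇒y≡ commonY u₀∈Bx) (sym (commonY⇒y≡ commonY u₁∈Bx))) (trans (sym w≡z₀) w≡z₁))

      -- N(x), N(u₀), N(u₁) contain M and pairwise meet only in M; v′ is adjacent to all of x, u₀, u₁
      -- except possibly the one vertex lost from N(v) in N(v′).
      M-closed : Closed class M
      M-closed {v} {v′} Mv vv′ with ∨≡true {v′ == v} vv′
      ... | inj₁ v′==v rewrite ==⇒≡ v′==v = Mv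
      ... | inj₂ v′∈Bv = choose (x ≟ y′) (u₀ ≟ y′)
        where
        e = exchange v′∈Bv
        y′ = Exchange.y e
        sees : ∀ {c} → adj c v ≡ true → c ≢ y′ → adj c v′ ≡ true
        sees cv c≢y′ = adj-sym (kept e (adj-sym cv) c≢y′)
        choose : Dec (x ≡ y′) → Dec (u₀ ≡ y′) → M v′ ≡ true
        choose (yes x≡y′) _ = N∩N⊆M′ (sees (M⊆N u₀∈Bx Mv) (λ u₀≡y′ → proj₁ (∈B⇒ u₀∈Bx) (trans u₀≡y′ (sym x≡y′))))
                                     (sees (M⊆N u₁∈Bx Mv) (λ u₁≡y′ → proj₁ (∈B⇒ u₁∈Bx) (trans u₁≡y′ (sym x≡y′))))
        choose (no x≢y′) (yes u₀≡y′) = N∩N⊆M u₁∈Bx (sees (proj₁ (∖-elim (adj x) Mv)) x≢y′)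
                                                   (sees (M⊆N u₁∈Bx Mv) (λ u₁≡y′ → u₁≢u₀ (trans u₁≡y′ (sym u₀≡y′))))
        choose (no x≢y′) (no u₀≢y′)  = N∩N⊆M u₀∈Bx (sees (proj₁ (∖-elim (adj x) Mv)) x≢y′) (sees (M⊆N u₀∈Bx Mv) u₀≢y′)

      β+1∣b : ∀ r → suc (β r) ∣ b
      β+1∣b r = subst (suc (β r) ∣_) ∣M∣≡b (class-closed⇒β+1∣ r M M-closed)

    module CommonZClosed {x z u₀ u₁} (commonZ : CommonZ x z) (u₀∈Bx : u₀ ∈B x) (u₁∈Bx : u₁ ∈B x) (u₁≢u₀ : u₁ ≢ u₀) where
      private
        z∉Nx = proj₁ commonZ
        B~z = proj₂ commonZ

      P : Fin n → Bool
      P w = adj x w ∨ w == z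

      ∣P∣≡b+2 : count P ≡ b + 2
      ∣P∣≡b+2 = trans (count-∨ (adj x) (_== z) disjoint) (trans (cong₂ _+_ (degree x) (count-== z)) (sym (+-suc b 1)))
        where
        disjoint : ∀ w → adj x w ∧ w == z ≡ false
        disjoint w with adj x w in xw
        ... | false = refl
        ... | true  = ≢⇒==-false λ { refl → not-¬ xw z∉Nx }

      N⊆P : ∀ {u w} → u ∈B x → adj u w ≡ true → P w ≡ true
      N⊆P u∈Bx uw with adj-u (exchange u∈Bx) uw
      ... | inj₁ (xw , _) = cong (_∨ _) xw
      ... | inj₂ w≡zᵤ     = ∨-introʳ (≡⇒== (trans w≡zᵤ (commonZ⇒z≡ commonZ u∈Bx)))

      P∖y⊆N : ∀ {u w} → (u∈Bx : u ∈B x) → P w ≡ true → w ≢ Exchange.y (exchange u∈Bx) → adj u w ≡ true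
      P∖y⊆N {u} u∈Bx Pw w≢y with ∨≡true Pw
      ... | inj₁ xw   = kept (exchange u∈Bx) xw w≢y
      ... | inj₂ w==z rewrite ==⇒≡ w==z = B~z u u∈Bx

      P∖z⊆N : ∀ {w} → P w ≡ true → w ≢ z → adj x w ≡ true
      P∖z⊆N Pw w≢z with ∨≡true Pw
      ... | inj₁ xw   = xw
      ... | inj₂ w==z = ⊥-elim (w≢z (==⇒≡ w==z))

      private
        y₀ = Exchange.y (exchange u₀∈Bx)
        y₁ = Exchange.y (exchange u₁∈Bx)

        z≢y : ∀ {u} (u∈Bx : u ∈B x) → z ≢ Exchange.y (exchange u∈Bx)
        z≢y u∈Bx refl = not-¬ (x~y (exchange u∈Bx)) z∉Nx

        y₀≢y₁ : y₀ ≢ y₁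
        y₀≢y₁ y₀≡y₁ = ¬same-exchange (exchange u₀∈Bx) (exchange u₁∈Bx) (≢-sym u₁≢u₀) y₀≡y₁
          (trans (commonZ⇒z≡ commonZ u₀∈Bx) (sym (commonZ⇒z≡ commonZ u₁∈Bx)))

      -- N(c) ⊆ P ⊆ N(c) ∪ {d_c} for c = x, u₀, u₁ with distinct d_x = z, d_u = y_u;
      -- some c has v ≠ d_c and is not the vertex lost from N(v) in N(v′).
      P-closed : Closed class P
      P-closed {v} {v′} Pv vv′ with ∨≡true {v′ == v} vv′
      ... | inj₁ v′==v rewrite ==⇒≡ v′==v = Pv
      ... | inj₂ v′∈Bv = choose (v ≟ z) (x ≟ y′) (v ≟ y₀) (u₀ ≟ y′)
        where
        e = exchange v′∈Bv
        y′ = Exchange.y e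
        sees : ∀ {c} → adj c v ≡ true → c ≢ y′ → adj c v′ ≡ true
        sees cv c≢y′ = adj-sym (kept e (adj-sym cv) c≢y′)
        via-x : v ≢ z → x ≢ y′ → P v′ ≡ true
        via-x v≢z x≢y′ = cong (_∨ (v′ == z)) (sees (P∖z⊆N Pv v≢z) x≢y′)
        via : ∀ {u} (u∈Bx : u ∈B x) → v ≢ Exchange.y (exchange u∈Bx) → u ≢ y′ → P v′ ≡ true
        via u∈Bx v≢y u≢y′ = N⊆P u∈Bx (sees (P∖y⊆N u∈Bx Pv v≢y) u≢y′)
        u≢x : ∀ {u} → u ∈B x → u ≢ x
        u≢x = proj₁ ∘ ∈B⇒
        choose : Dec (v ≡ z) → Dec (x ≡ y′) → Dec (v ≡ y₀) → Dec (u₀ ≡ y′) → P v′ ≡ true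
        choose (no v≢z)  (no x≢y′)  _           _            = via-x v≢z x≢y′
        choose _         _          (no v≢y₀)   (no u₀≢y′)   = via u₀∈Bx v≢y₀ u₀≢y′
        choose (yes refl) _         (yes z≡y₀)  _            = ⊥-elim (z≢y u₀∈Bx z≡y₀)
        choose (yes refl) _         _           (yes u₀≡y′)  = via u₁∈Bx (z≢y u₁∈Bx) (λ u₁≡y′ → u₁≢u₀ (trans u₁≡y′ (sym u₀≡y′)))
        choose _         (yes x≡y′) (yes refl)  _            = via u₁∈Bx y₀≢y₁ (λ u₁≡y′ → u≢x u₁∈Bx (trans u₁≡y′ (sym x≡y′)))
        choose _         (yes x≡y′) _           (yes u₀≡y′)  = ⊥-elim (u≢x u₀∈Bx (trans u₀≡y′ (sym x≡y′)))

      β+1∣b+2 : ∀ r → suc (β r) ∣ b + 2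
      β+1∣b+2 r = subst (suc (β r) ∣_) ∣P∣≡b+2 (class-closed⇒β+1∣ r P P-closed)

    module _ (β>1 : ∀ v → 1 < ∣ B Γ b v ∣) where

      2≤β : ∀ x → 2 ≤ β x
      2≤β x = subst (2 ≤_) (∣tabulate∣≡count (inB Γ b x)) (β>1 x)

      record Partners (x : Fin n) : Set where
        field
          u₀ u₁ : Fin n
          u₀∈Bx : u₀ ∈B x
          u₁∈Bx : u₁ ∈B x
          u₁≢u₀ : u₁ ≢ u₀

      partners : ∀ x → Partners x
      partners x = record { u₀ = u₀ ; u₁ = proj₁ second ; u₀∈Bx = u₀∈Bx ; u₁∈Bx = proj₁ (proj₂ second) ; u₁≢u₀ = proj₂ (proj₂ second) }
        where
        first = count-witness (inB Γ b x) (≤-trans (s≤s z≤n) (2≤β x))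
        u₀ = proj₁ first
        u₀∈Bx = proj₂ first
        second = 2≤count⇒another (inB Γ b x) (2≤β x) u₀∈Bx

      classify : ∀ x → (∃ λ y → CommonY x y) ⊎ (∃ λ z → CommonZ x z)
      classify x = CommonY⊎CommonZ x u₀∈Bx u₁∈Bx u₁≢u₀
        where open Partners (partners x)

      -- The common class size β + 1 ≥ 3 would divide both b and b + 2.
      ¬CommonY×CommonZ : ∀ {x y x′ z} → CommonY x y → CommonZ x′ z → ⊥
      ¬CommonY×CommonZ {x} {x′ = x′} commonY commonZ =
        <-irrefl refl (≤-trans (s≤s (2≤β x)) (∣⇒≤ (∣m+n∣m⇒∣n β+1∣b+2 β+1∣b)))
        where
        module X = Partners (partners x)
        module X′ = Partners (partners x′)
        β+1∣b = CommonYClosed.β+1∣b commonY X.u₀∈Bx X.u₁∈Bx X.u₁≢u₀ x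
        β+1∣b+2 = CommonZClosed.β+1∣b+2 commonZ X′.u₀∈Bx X′.u₁∈Bx X′.u₁≢u₀ x

      private
        u₀∈B : ∀ v → Partners.u₀ (partners v) ∈B v
        u₀∈B v = Partners.u₀∈Bx (partners v)

      all-typeA1⊎typeC : ∀ {x y} → CommonY x y → ∀ v → TypeA1 Γ b v ⊎ TypeC Γ b v
      all-typeA1⊎typeC commonY v = by-class (classify v)
        where
        by-class : (∃ λ y → CommonY v y) ⊎ (∃ λ z → CommonZ v z) → TypeA1 Γ b v ⊎ TypeC Γ b v
        by-class (inj₁ (_ , commonYᵥ)) = commonY⇒typeA1⊎typeC (u₀∈B v) commonYᵥ
        by-class (inj₂ (_ , commonZᵥ)) = ⊥-elim (¬CommonY×CommonZ commonY commonZᵥ)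

      all-typeA2⊎typeB : ∀ {x z} → CommonZ x z → ∀ v → TypeA2 Γ b v ⊎ TypeB Γ b v
      all-typeA2⊎typeB commonZ v = by-class (classify v)
        where
        by-class : (∃ λ y → CommonY v y) ⊎ (∃ λ z → CommonZ v z) → TypeA2 Γ b v ⊎ TypeB Γ b v
        by-class (inj₁ (_ , commonYᵥ)) = ⊥-elim (¬CommonY×CommonZ commonYᵥ commonZ)
        by-class (inj₂ (_ , commonZᵥ)) = commonZ⇒typeA2⊎typeB (u₀∈B v) commonZᵥ

      uniform-type : Fin n → (∀ v → TypeA1 Γ b v ⊎ TypeC Γ b v) ⊎ (∀ v → TypeA2 Γ b v ⊎ TypeB Γ b v)
      uniform-type x = Sum.map (all-typeA1⊎typeC ∘ proj₂) (all-typeA2⊎typeB ∘ proj₂) (classify x)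

lemma16 : (n k b a : ℕ) (Γ : Graph n) →
    IsStrictlyDeza Γ k b a →
    k ≡ suc b →
    (∀ v → 1 < ∣ B Γ b v ∣) →
    (∀ v → TypeA1 Γ b v ⊎ TypeC Γ b v) ⊎ (∀ v → TypeA2 Γ b v ⊎ TypeB Γ b v)
lemma16 n .(suc b) b a Γ ((_ , regular , a≤b , dichotomy) , diameter2 , notSRG) refl β>1 =
  uniform-type β>1 (proj₁ (proj₂ diameter2))
  where open DezaValencyBPlusOne Γ regular a≤b dichotomy
        open StrictlyDeza diameter2 notSRG
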